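{- Let $k\ge 4$ and let $H$ be the $k$-th power of the Hamilton cycle on $[n]$. For every good spanning subgraph $F\subset H$, $$\frac{X_F(H)}{X_F(K_n)}\le\left(\frac{3ke}{n}\right)^{r(F)}.$$
   Context: $H$ has vertex set $[n]$ and edges $\{v,v+i\}$ for $v\in[n]$, $i\in[k]$ (addition modulo $n$). A graph $F$ is good if $V(F)=[n]$ and no connected component of $F$ has exactly two vertices. $r(F)=|F|-c(F)$, where $|F|$ is the number of vertices and $c(F)$ the number of connected components. $X_F(G)$ is the number of copies of $F$ in $G$, and $K_n$ is the complete graph on $[n]$. -}

module Defs where

open import Data.Nat using (ℕ; zero; suc; _+_; _*_; _∸_; _^_; _≤_; _<_; _<ᵇ_; _≡ᵇ_; _!; _/_; _%_)
open import Data.Nat.Properties using (_!≢0)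
open import Data.Bool using (Bool; true; false; _∧_; _∨_; not; _xor_)
open import Data.Fin using (Fin; toℕ)
open import Data.List using (List; []; _∷_; map; concatMap; length; filterᵇ; deduplicateᵇ; allFin; upTo)
open import Data.Bool.ListAction using (any; all)
open import Data.Nat.ListAction using (sum)
open import Data.Vec using (Vec; lookup) renaming ([] to []ᵥ; _∷_ to _∷ᵥ_)
open import Relation.Binary.PropositionalEquality using (_≡_; _≢_)

_==_ : ∀ {n} → Fin n → Fin n → Bool
u == v = toℕ u ≡ᵇ toℕ v

anyV : ∀ {n} → (Fin n → Bool) → Bool
anyV {n} p = any p (allFin n)

allV : ∀ {n} → (Fin n → Bool) → Bool
allV {n} p = all p (allFin n)

-- A graph on the vertex set [n] (= Fin n), given by its adjacency relation.
-- Simple graphs are those satisfying Symmetric and Loopless below.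
Graph : ℕ → Set
Graph n = Fin n → Fin n → Bool

Symmetric : ∀ {n} → Graph n → Set
Symmetric F = ∀ u v → F u v ≡ F v u

Loopless : ∀ {n} → Graph n → Set
Loopless F = ∀ u → F u u ≡ false

_⊆ᴳ_ : ∀ {n} → Graph n → Graph n → Set
F ⊆ᴳ G = ∀ u v → F u v ≡ true → G u v ≡ true

Complete : (n : ℕ) → Graph n
Complete n u v = not (u == v)

-- H = k-th power of the Hamilton cycle on [n]: edges {v, v+i} for i ∈ {1,…,k},
-- addition modulo n (loops discarded, multiple edges identified).
HamPow : (n k : ℕ) → Graph n
HamPow zero    k ()
HamPow (suc m) k u w =
  not (u == w) ∧ any (λ j → let i = suc j in
                            (((toℕ u + i) % suc m) ≡ᵇ toℕ w) ∨ (((toℕ w + i) % suc m) ≡ᵇ toℕ u))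
                     (upTo k)

reachWithin : ∀ {n} → Graph n → ℕ → Graph n
reachWithin F zero    u v = u == v
reachWithin F (suc t) u v = reachWithin F t u v ∨ anyV (λ w → reachWithin F t u w ∧ F w v)

-- u and v lie in the same connected component (walks of length ≤ n suffice).
Connected : ∀ {n} → Graph n → Graph n
Connected {n} F = reachWithin F n

compSize : ∀ {n} → Graph n → Fin n → ℕ
compSize {n} F v = length (filterᵇ (Connected F v) (allFin n))

-- c(F): number of connected components (= number of vertices that are the
-- least vertex of their component).
numComponents : ∀ {n} → Graph n → ℕ
numComponents {n} F =
  length (filterᵇ (λ v → allV (λ u → not ((toℕ u <ᵇ toℕ v) ∧ Connected F u v))) (allFin n))

-- r(F) = |F| - c(F), with |F| = n.
rank : ∀ {n} → Graph n → ℕ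
rank {n} F = n ∸ numComponents F

Good : ∀ {n} → Graph n → Set
Good F = ∀ v → compSize F v ≢ 2

allMaps : (n m : ℕ) → List (Vec (Fin n) m)
allMaps n zero    = []ᵥ ∷ []
allMaps n (suc m) = concatMap (λ x → map (x ∷ᵥ_) (allMaps n m)) (allFin n)

isInjective : ∀ {n} → Vec (Fin n) n → Bool
isInjective σ = allV (λ u → allV (λ v → (u == v) ∨ not (lookup σ u == lookup σ v)))

permutations : (n : ℕ) → List (Vec (Fin n) n)
permutations n = filterᵇ isInjective (allMaps n n)

image : ∀ {n} → Vec (Fin n) n → Graph n → Graph n
image σ F a b = anyV (λ u → anyV (λ v → (lookup σ u == a) ∧ (lookup σ v == b) ∧ F u v))

sameGraph : ∀ {n} → Graph n → Graph n → Bool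
sameGraph F G = allV (λ a → allV (λ b → not (F a b xor G a b)))

subGraphᵇ : ∀ {n} → Graph n → Graph n → Bool
subGraphᵇ F G = allV (λ a → allV (λ b → not (F a b) ∨ G a b))

-- X_F(G): the number of copies of F in G, i.e. the number of distinct
-- (spanning, since V(F) = [n]) subgraphs of G isomorphic to F.
-- Every copy is σ(F) for some permutation σ; distinct copies are counted once.
copies : ∀ {n} → Graph n → Graph n → ℕ
copies {n} F G =
  length (deduplicateᵇ sameGraph
           (filterᵇ (λ F' → subGraphᵇ F' G) (map (λ σ → image σ F) (permutations n))))

-- Exponential (no reals in the library).
-- expScaled x N = N! · Σ_{j=0}^{N} x^j / j!   (an exact natural number),
-- so expScaled x N / N! is the N-th partial sum of the series of e^x.
expScaled : ℕ → ℕ → ℕ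
expScaled x N = sum (map (λ j → x ^ j * ((N !) / (j !)) {{j !≢0}}) (upTo (suc N)))

{-# OPTIONS --safe #-}

-- Writing e(F, G) for the number of permutations σ with σ(F) ⊆ G, every copy of F in G is hit by exactly
-- |Aut F| of them, so X_F(G) · |Aut F| = e(F, G); as every permutation embeds F into K_n, the ratio
-- X_F(H) / X_F(K_n) equals e(F, H) / n!.  To bound e(F, H), place the vertices of F one by one:
-- first the s roots of the non-trivial components (at most n (n − 1) ⋯ (n − s + 1) choices), then the
-- r = rank F remaining non-isolated vertices in breadth-first order, each adjacent to a vertex already
-- placed and so with at most 2k choices because H has maximum degree 2k, and finally the c isolated
-- vertices (c! choices).  Goodness gives 3s ≤ r + s, hence 2n ≤ 3(r + c), and elementary estimates turn
-- (n)ₛ (2k)ʳ c! / n! into at most (3k / n)ʳ rʳ / r! ≤ (3ke / n)ʳ, where eʳ is represented by the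
-- partial sum expScaled r r / r!.

module Submission where

open import Defs

import Algebra.Properties.CommutativeSemigroup as CommutativeSemigroupₚ
open import Data.Bool as Bool using (Bool; true; false; _∧_; _∨_; not; if_then_else_; T; T?; _xor_)
open import Data.Bool.ListAction using (any; all)
open import Data.Bool.Properties using (∧-comm; ∧-conicalˡ; ∧-conicalʳ; ∧-zeroʳ; ∧-identityʳ; not-¬; ¬-not; not-injective; xor-same; ⇔→≡; T-≡)
open import Data.Empty using (⊥; ⊥-elim)
open import Data.Fin as Fin using (Fin; toℕ)
import Data.Fin.Properties as Finₚ
open import Data.List using (List; []; _∷_; _++_; _ʳ++_; map; length; filterᵇ; concatMap; deduplicateᵇ; allFin; upTo)
import Data.List.Properties as Listₚ
open import Data.List.Membership.Propositional using (_∈_; _∉_; find)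
open import Data.List.Membership.Propositional.Properties using (∈-map⁺; ∈-map⁻; ∈-++⁺ˡ; ∈-++⁺ʳ; ∈-++⁻; ∈-∃++; ∈-concatMap⁺; ∈-concatMap⁻; ∈-tabulate⁺; ∈-filter⁺; ∈-filter⁻; ∈-deduplicate⁻; ∈-upTo⁺)
open import Data.List.Relation.Unary.All as All using (All; []; _∷_)
import Data.List.Relation.Unary.All.Properties as Allₚ
open import Data.List.Relation.Unary.AllPairs using ([]; _∷_)
open import Data.List.Relation.Unary.Any as Any using (Any; here; there)
import Data.List.Relation.Unary.Any.Properties as Anyₚ
import Data.List.Relation.Unary.Unique.DecSetoid as UniqueDS
open import Data.List.Relation.Unary.Unique.DecSetoid.Properties using (deduplicate-!)
open import Data.List.Relation.Unary.Unique.Propositional using (Unique)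
import Data.List.Relation.Unary.Unique.Propositional.Properties as Uniqueₚ
open import Data.Nat using (ℕ; zero; suc; _+_; _*_; _∸_; _^_; _≤_; _<_; _≤?_; _!; z≤n; s≤s; s≤s⁻¹; _≡ᵇ_; _<ᵇ_; _%_; NonZero)
open import Data.Nat.Combinatorics.Base using (_P′_)
open import Data.Nat.Combinatorics.Specification using (nP′n≡n!)
open import Data.Nat.DivMod using (_/_; n/n≡1; %-distribˡ-+; m%n%n≡m%n; [m+kn]%n≡m%n; m<n⇒m%n≡m)
open import Data.Nat.ListAction using (sum)
open import Data.Nat.Properties
open import Data.Nat.Tactic.RingSolver using (solve-∀)
open import Data.Product as Product using (Σ; _×_; _,_; proj₁; proj₂; ∃-syntax)
open import Data.Sum as Sum using (_⊎_; inj₁; inj₂)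
open import Data.Vec using (Vec; lookup; tabulate) renaming ([] to []ᵥ; _∷_ to _∷ᵥ_)
import Data.Vec.Properties as Vecₚ
open import Function using (_∘_; id; case_of_)
open import Function.Bundles using (Equivalence; mk⇔)
open import Function.Definitions using (Injective)
open import Relation.Binary.Bundles using (DecSetoid)
open import Relation.Binary.Definitions using (tri<; tri≈; tri>)
open import Relation.Binary.PropositionalEquality using (_≡_; _≢_; refl; sym; trans; cong; cong₂; subst; subst₂; module ≡-Reasoning)
open import Relation.Nullary using (¬_; yes; no)

module +-Semigroupₚ = CommutativeSemigroupₚ +-commutativeSemigroup
module *-Semigroupₚ = CommutativeSemigroupₚ *-commutativeSemigroup

private
  variable
    A B : Set

T⇒≡true : ∀ {b} → T b → b ≡ true
T⇒≡true = Equivalence.to T-≡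

≡true⇒T : ∀ {b} → b ≡ true → T b
≡true⇒T = Equivalence.from T-≡

∧-true⁺ : ∀ {a b} → a ≡ true → b ≡ true → a ∧ b ≡ true
∧-true⁺ refl refl = refl

∧-true⁻ : ∀ a b → a ∧ b ≡ true → a ≡ true × b ≡ true
∧-true⁻ a b e = ∧-conicalˡ a b e , ∧-conicalʳ a b e

∨-true⁻ : ∀ {a b} → a ∨ b ≡ true → a ≡ true ⊎ b ≡ true
∨-true⁻ {true}  _ = inj₁ refl
∨-true⁻ {false} e = inj₂ e

∨-true⁺ʳ : ∀ {a b} → b ≡ true → a ∨ b ≡ true
∨-true⁺ʳ {true}  _ = refl
∨-true⁺ʳ {false} e = e

indicator : Bool → ℕ
indicator true  = 1
indicator false = 0

sumBy : (A → ℕ) → List A → ℕ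
sumBy f []       = 0
sumBy f (x ∷ xs) = f x + sumBy f xs

count : (A → Bool) → List A → ℕ
count p = sumBy (indicator ∘ p)

sumBy-cong : ∀ (f g : A → ℕ) xs → (∀ x → x ∈ xs → f x ≡ g x) → sumBy f xs ≡ sumBy g xs
sumBy-cong f g []       h = refl
sumBy-cong f g (x ∷ xs) h = cong₂ _+_ (h x (here refl)) (sumBy-cong f g xs (λ y m → h y (there m)))

sumBy-mono : ∀ (f g : A → ℕ) xs → (∀ x → x ∈ xs → f x ≤ g x) → sumBy f xs ≤ sumBy g xs
sumBy-mono f g []       h = z≤n
sumBy-mono f g (x ∷ xs) h = +-mono-≤ (h x (here refl)) (sumBy-mono f g xs (λ y m → h y (there m)))

sumBy-++ : ∀ (f : A → ℕ) xs ys → sumBy f (xs ++ ys) ≡ sumBy f xs + sumBy f ys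
sumBy-++ f []       ys = refl
sumBy-++ f (x ∷ xs) ys = trans (cong (f x +_) (sumBy-++ f xs ys)) (sym (+-assoc (f x) _ _))

sumBy-+ : ∀ (f g : A → ℕ) xs → sumBy (λ x → f x + g x) xs ≡ sumBy f xs + sumBy g xs
sumBy-+ f g []       = refl
sumBy-+ f g (x ∷ xs) = trans (cong (f x + g x +_) (sumBy-+ f g xs)) (+-Semigroupₚ.interchange (f x) (g x) _ _)

sumBy-const : ∀ c xs → sumBy (λ (_ : A) → c) xs ≡ length xs * c
sumBy-const c []       = refl
sumBy-const c (x ∷ xs) = cong (c +_) (sumBy-const c xs)

sumBy-*ʳ : ∀ (f : A → ℕ) c xs → sumBy (λ x → f x * c) xs ≡ sumBy f xs * c
sumBy-*ʳ f c []       = refl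
sumBy-*ʳ f c (x ∷ xs) = trans (cong (f x * c +_) (sumBy-*ʳ f c xs)) (sym (*-distribʳ-+ c (f x) _))

sumBy-concatMap : ∀ (f : B → ℕ) (g : A → List B) xs →
                  sumBy f (concatMap g xs) ≡ sumBy (sumBy f ∘ g) xs
sumBy-concatMap f g []       = refl
sumBy-concatMap f g (x ∷ xs) = trans (sumBy-++ f (g x) _) (cong (sumBy f (g x) +_) (sumBy-concatMap f g xs))

sumBy-map : ∀ (f : B → ℕ) (g : A → B) xs → sumBy f (map g xs) ≡ sumBy (f ∘ g) xs
sumBy-map f g []       = refl
sumBy-map f g (x ∷ xs) = cong (f (g x) +_) (sumBy-map f g xs)

sumBy-zero : ∀ (xs : List A) → sumBy (λ _ → 0) xs ≡ 0
sumBy-zero xs = trans (sumBy-const 0 xs) (*-zeroʳ (length xs))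

sumBy-comm : ∀ (f : A → B → ℕ) xs ys →
             sumBy (λ x → sumBy (f x) ys) xs ≡ sumBy (λ y → sumBy (λ x → f x y) xs) ys
sumBy-comm f []       ys = sym (sumBy-zero ys)
sumBy-comm f (x ∷ xs) ys =
  trans (cong (sumBy (f x) ys +_) (sumBy-comm f xs ys)) (sym (sumBy-+ (f x) _ ys))

length-filterᵇ : ∀ (p : A → Bool) xs → length (filterᵇ p xs) ≡ count p xs
length-filterᵇ p []       = refl
length-filterᵇ p (x ∷ xs) with p x
... | true  = cong suc (length-filterᵇ p xs)
... | false = length-filterᵇ p xs

∈-filterᵇ⁻ : ∀ (p : A → Bool) {xs y} → y ∈ filterᵇ p xs → y ∈ xs × p y ≡ true
∈-filterᵇ⁻ p m with y∈xs , py ← ∈-filter⁻ (T? ∘ p) m = y∈xs , T⇒≡true py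

∈-filterᵇ⁺ : ∀ (p : A → Bool) {xs y} → y ∈ xs → p y ≡ true → y ∈ filterᵇ p xs
∈-filterᵇ⁺ p m py = ∈-filter⁺ (T? ∘ p) m (≡true⇒T py)

count-≤-length : ∀ (p : A → Bool) xs → count p xs ≤ length xs
count-≤-length p []       = z≤n
count-≤-length p (x ∷ xs) with p x
... | true  = s≤s (count-≤-length p xs)
... | false = m≤n⇒m≤1+n (count-≤-length p xs)

indicator-mono : ∀ {a b} → (a ≡ true → b ≡ true) → indicator a ≤ indicator b
indicator-mono {false}         _ = z≤n
indicator-mono {true}  {true}  _ = ≤-refl
indicator-mono {true}  {false} h with () ← h refl

count-mono : ∀ (p q : A → Bool) xs → (∀ x → x ∈ xs → p x ≡ true → q x ≡ true) → count p xs ≤ count q xs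
count-mono p q xs h = sumBy-mono _ _ xs (λ x m → indicator-mono (h x m))

count-cong : ∀ (p q : A → Bool) xs → (∀ x → x ∈ xs → p x ≡ q x) → count p xs ≡ count q xs
count-cong p q xs h = sumBy-cong _ _ xs (λ x m → cong indicator (h x m))

count-filterᵇ : ∀ (p q : A → Bool) xs → count p (filterᵇ q xs) ≡ count (λ x → q x ∧ p x) xs
count-filterᵇ p q []       = refl
count-filterᵇ p q (x ∷ xs) with q x
... | true  = cong (indicator (p x) +_) (count-filterᵇ p q xs)
... | false = count-filterᵇ p q xs

count-≥1 : ∀ (p : A → Bool) {xs x} → x ∈ xs → p x ≡ true → 1 ≤ count p xs
count-≥1 p {y ∷ xs} (here refl) px rewrite px = s≤s z≤n
count-≥1 p {y ∷ xs} (there m)   px = ≤-trans (count-≥1 p m px) (m≤n+m _ (indicator (p y)))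

count-< : ∀ (p q : A → Bool) xs → (∀ x → x ∈ xs → p x ≡ true → q x ≡ true) →
          ∀ {z} → z ∈ xs → q z ≡ true → p z ≡ false → count p xs < count q xs
count-< p q (x ∷ xs) h (here refl) qz pz rewrite qz | pz = s≤s (count-mono p q xs (λ y m → h y (there m)))
count-< p q (x ∷ xs) h (there m) qz pz =
  +-mono-≤-< (indicator-mono (h x (here refl))) (count-< p q xs (λ y m → h y (there m)) m qz pz)

count-≤1 : ∀ (p : A → Bool) xs → Unique xs → (∀ {x y} → x ∈ xs → y ∈ xs → p x ≡ true → p y ≡ true → x ≡ y) →
           count p xs ≤ 1
count-≤1 p []       _           h = z≤n
count-≤1 p (x ∷ xs) (x∉ ∷ uxs) h with p x in px
... | false = count-≤1 p xs uxs (λ mx my → h (there mx) (there my))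
... | true  = s≤s (≤-reflexive (none xs x∉ (λ my py → h (here refl) (there my) px py)))
  where
  none : ∀ ys → All (x ≢_) ys → (∀ {y} → y ∈ ys → p y ≡ true → x ≡ y) → count p ys ≡ 0
  none []       _          _ = refl
  none (y ∷ ys) (x≢y ∷ ne) g with p y in py
  ... | true  = ⊥-elim (x≢y (g (here refl) py))
  ... | false = none ys ne (λ m → g (there m))

count-∨-≤ : ∀ (p q : A → Bool) xs → count (λ x → p x ∨ q x) xs ≤ count p xs + count q xs
count-∨-≤ p q []       = z≤n
count-∨-≤ p q (x ∷ xs) = ≤-trans (+-mono-≤ (indicator-∨ (p x) (q x)) (count-∨-≤ p q xs))
                                 (≤-reflexive (+-Semigroupₚ.interchange (indicator (p x)) _ _ _))
  where
  indicator-∨ : ∀ a b → indicator (a ∨ b) ≤ indicator a + indicator b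
  indicator-∨ true  b = s≤s z≤n
  indicator-∨ false b = ≤-refl

count-split : ∀ (p q : A → Bool) xs → count p xs ≡ count (λ x → p x ∧ q x) xs + count (λ x → p x ∧ not (q x)) xs
count-split p q []       = refl
count-split p q (x ∷ xs) with p x | q x
... | true  | true  = cong suc (count-split p q xs)
... | true  | false = trans (cong suc (count-split p q xs)) (sym (+-suc _ _))
... | false | _     = count-split p q xs

count-∨ : ∀ (p q : A → Bool) xs → (∀ {x} → p x ≡ true → q x ≡ false) →
          count (λ x → p x ∨ q x) xs ≡ count p xs + count q xs
count-∨ p q []       _        = refl
count-∨ p q (x ∷ xs) disjoint with p x in px
... | true  rewrite disjoint px = cong suc (count-∨ p q xs disjoint)
... | false = trans (cong (indicator (q x) +_) (count-∨ p q xs disjoint)) (+-Semigroupₚ.x∙yz≈y∙xz (indicator (q x)) (count p xs) (count q xs))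

count-not : ∀ (p : A → Bool) xs → count (not ∘ p) xs + count p xs ≡ length xs
count-not p []       = refl
count-not p (x ∷ xs) with p x
... | true  = trans (+-suc _ _) (cong suc (count-not p xs))
... | false = cong suc (count-not p xs)

any-true⁻ : ∀ (p : A → Bool) xs → any p xs ≡ true → ∃[ x ] x ∈ xs × p x ≡ true
any-true⁻ p xs e with x , x∈xs , px ← find (Anyₚ.any⁻ p xs (≡true⇒T e)) = x , x∈xs , T⇒≡true px

any-true⁺ : ∀ (p : A → Bool) {xs x} → x ∈ xs → p x ≡ true → any p xs ≡ true
any-true⁺ p x∈xs px = T⇒≡true (Anyₚ.any⁺ p (Any.map (λ { refl → ≡true⇒T px }) x∈xs))

all-true⁻ : ∀ (p : A → Bool) xs → all p xs ≡ true → ∀ {x} → x ∈ xs → p x ≡ true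
all-true⁻ p xs e x∈xs = T⇒≡true (All.lookup (Allₚ.all⁺ p xs (≡true⇒T e)) x∈xs)

all-true⁺ : ∀ (p : A → Bool) xs → (∀ {x} → x ∈ xs → p x ≡ true) → all p xs ≡ true
all-true⁺ p xs h = T⇒≡true (Allₚ.all⁻ p (All.tabulate (≡true⇒T ∘ h)))

unique⊆⇒length≤ : ∀ {xs ys : List A} → Unique xs → (∀ {z} → z ∈ xs → z ∈ ys) → length xs ≤ length ys
unique⊆⇒length≤ {xs = []}     _            _   = z≤n
unique⊆⇒length≤ {xs = x ∷ xs} (x∉xs ∷ uxs) sub with as , bs , refl ← ∈-∃++ (sub (here refl)) = begin
  suc (length xs)             ≤⟨ s≤s (unique⊆⇒length≤ uxs sub′) ⟩
  suc (length (as ++ bs))     ≡⟨ cong suc (Listₚ.length-++ as) ⟩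
  suc (length as + length bs) ≡⟨ +-suc (length as) (length bs) ⟨
  length as + suc (length bs) ≡⟨ Listₚ.length-++ as ⟨
  length (as ++ x ∷ bs)       ∎
  where
  open ≤-Reasoning
  sub′ : ∀ {z} → z ∈ xs → z ∈ as ++ bs
  sub′ z∈xs with ∈-++⁻ as (sub (there z∈xs))
  ... | inj₁ z∈as          = ∈-++⁺ˡ z∈as
  ... | inj₂ (here refl)   = ⊥-elim (All.lookup x∉xs z∈xs refl)
  ... | inj₂ (there z∈bs) = ∈-++⁺ʳ as z∈bs

injection⇒length≤ : ∀ {xs : List A} {ys : List B} (f : A → B) → Injective _≡_ _≡_ f → Unique xs →
                    (∀ {x} → x ∈ xs → f x ∈ ys) → length xs ≤ length ys
injection⇒length≤ {xs = xs} f f-inj uxs f∈ys =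
  subst (_≤ _) (Listₚ.length-map f xs) (unique⊆⇒length≤ (Uniqueₚ.map⁺ f-inj uxs) image⊆)
  where
  image⊆ : ∀ {y} → y ∈ map f xs → y ∈ _
  image⊆ y∈ with x , x∈xs , refl ← ∈-map⁻ f y∈ = f∈ys x∈xs

module _ {n : ℕ} where

  ==⇒≡ : (u v : Fin n) → (u == v) ≡ true → u ≡ v
  ==⇒≡ u v e = Finₚ.toℕ-injective (≡ᵇ⇒≡ (toℕ u) (toℕ v) (≡true⇒T e))

  ≡⇒== : (u v : Fin n) → u ≡ v → (u == v) ≡ true
  ≡⇒== u _ refl = T⇒≡true (≡⇒≡ᵇ (toℕ u) (toℕ u) refl)

  ==-refl : (u : Fin n) → (u == u) ≡ true
  ==-refl u = ≡⇒== u u refl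

  ≢⇒==-false : (u v : Fin n) → u ≢ v → (u == v) ≡ false
  ≢⇒==-false u v u≢v = ¬-not (u≢v ∘ ==⇒≡ u v)

  ==-sym : (u v : Fin n) → (u == v) ≡ (v == u)
  ==-sym u v = ⇔→≡ (mk⇔ (≡⇒== v u ∘ sym ∘ ==⇒≡ u v) (≡⇒== u v ∘ sym ∘ ==⇒≡ v u))

  ∈-allFin : (u : Fin n) → u ∈ allFin n
  ∈-allFin u = ∈-tabulate⁺ u

  allFin-unique : Unique (allFin n)
  allFin-unique = Uniqueₚ.allFin⁺ n

  length-allFin : length (allFin n) ≡ n
  length-allFin = Listₚ.length-tabulate id

  anyV⁻ : (p : Fin n → Bool) → anyV p ≡ true → ∃[ x ] p x ≡ true
  anyV⁻ p e with x , _ , px ← any-true⁻ p (allFin n) e = x , px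

  anyV⁺ : (p : Fin n → Bool) (x : Fin n) → p x ≡ true → anyV p ≡ true
  anyV⁺ p x = any-true⁺ p (∈-allFin x)

  allV⁻ : (p : Fin n → Bool) → allV p ≡ true → ∀ x → p x ≡ true
  allV⁻ p e x = all-true⁻ p (allFin n) e (∈-allFin x)

  allV⁺ : (p : Fin n → Bool) → (∀ x → p x ≡ true) → allV p ≡ true
  allV⁺ p h = all-true⁺ p (allFin n) (λ {x} _ → h x)

  count-allFin-≤ : (p : Fin n → Bool) → count p (allFin n) ≤ n
  count-allFin-≤ p = subst (count p (allFin n) ≤_) length-allFin (count-≤-length p (allFin n))

  count-== : (a : Fin n) → count (_== a) (allFin n) ≡ 1
  count-== a = ≤-antisym (count-≤1 _ (allFin n) allFin-unique (λ _ _ x=a y=a → trans (==⇒≡ _ a x=a) (sym (==⇒≡ _ a y=a))))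
                         (count-≥1 _ (∈-allFin a) (==-refl a))

  count-≥2 : (p : Fin n → Bool) {x y : Fin n} → x ≢ y → p x ≡ true → p y ≡ true → 2 ≤ count p (allFin n)
  count-≥2 p {x} {y} x≢y px py = subst (2 ≤_) (sym (count-split p (_== x) (allFin n)))
    (+-mono-≤ (count-≥1 _ (∈-allFin x) (∧-true⁺ px (==-refl x)))
              (count-≥1 _ (∈-allFin y) (∧-true⁺ py (cong not (≢⇒==-false y x (x≢y ∘ sym))))))

  count-complement : ∀ (p : Fin n → Bool) m → count p (allFin n) ≡ m → count (not ∘ p) (allFin n) ≡ n ∸ m
  count-complement p m count≡m = begin
    count (not ∘ p) (allFin n)                              ≡⟨ m+n∸n≡m _ m ⟨
    count (not ∘ p) (allFin n) + m ∸ m                      ≡⟨ cong (λ c → count (not ∘ p) (allFin n) + c ∸ m) count≡m ⟨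
    count (not ∘ p) (allFin n) + count p (allFin n) ∸ m     ≡⟨ cong (_∸ m) (trans (count-not p (allFin n)) length-allFin) ⟩
    n ∸ m                                                   ∎
    where open ≡-Reasoning

-- Permutations

IsInjective : ∀ {n m} → Vec (Fin n) m → Set
IsInjective σ = Injective _≡_ _≡_ (lookup σ)

lookup-extensionality : ∀ {m} (s t : Vec A m) → (∀ i → lookup s i ≡ lookup t i) → s ≡ t
lookup-extensionality s t h =
  trans (sym (Vecₚ.tabulate∘lookup s)) (trans (Vecₚ.tabulate-cong h) (Vecₚ.tabulate∘lookup t))

∈-allMaps : ∀ n m (t : Vec (Fin n) m) → t ∈ allMaps n m
∈-allMaps n zero    []ᵥ       = here refl
∈-allMaps n (suc m) (x ∷ᵥ t) =
  ∈-concatMap⁺ _ (Any.map (λ { refl → ∈-map⁺ (x ∷ᵥ_) (∈-allMaps n m t) }) (∈-allFin x))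

allMaps-unique : ∀ n m → Unique (allMaps n m)
allMaps-unique n zero    = [] ∷ []
allMaps-unique n (suc m) = prefixes-unique (allFin n) allFin-unique
  where
  ∷ᵥ-injectiveˡ : ∀ {x y : Fin n} {s t : Vec (Fin n) m} → x ∷ᵥ s ≡ y ∷ᵥ t → x ≡ y
  ∷ᵥ-injectiveˡ refl = refl
  ∷ᵥ-injectiveʳ : ∀ {x y : Fin n} {s t : Vec (Fin n) m} → x ∷ᵥ s ≡ y ∷ᵥ t → s ≡ t
  ∷ᵥ-injectiveʳ refl = refl
  prefixes-unique : ∀ xs → Unique xs → Unique (concatMap (λ x → map (x ∷ᵥ_) (allMaps n m)) xs)
  prefixes-unique []       _           = []
  prefixes-unique (x ∷ xs) (x∉xs ∷ uxs) =
    Uniqueₚ.++⁺ (Uniqueₚ.map⁺ ∷ᵥ-injectiveʳ (allMaps-unique n m)) (prefixes-unique xs uxs) disjoint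
    where
    disjoint : ∀ {v} → v ∈ map (x ∷ᵥ_) (allMaps n m) × v ∈ concatMap (λ y → map (y ∷ᵥ_) (allMaps n m)) xs → ⊥
    disjoint (v∈x∷ , v∈rest) with _ , _ , refl ← ∈-map⁻ (x ∷ᵥ_) v∈x∷ = go x∉xs (∈-concatMap⁻ _ v∈rest)
      where
      go : ∀ {ys t} → All (x ≢_) ys → Any (λ y → x ∷ᵥ t ∈ map (y ∷ᵥ_) (allMaps n m)) ys → ⊥
      go (x≢y ∷ _)  (here m) with _ , _ , e ← ∈-map⁻ _ m = x≢y (∷ᵥ-injectiveˡ e)
      go (_ ∷ ne) (there m) = go ne m

module _ {n : ℕ} where

  isInjective⁻ : (σ : Vec (Fin n) n) → isInjective σ ≡ true → IsInjective σ
  isInjective⁻ σ e {u} {v} σu≡σv with ∨-true⁻ (allV⁻ _ (allV⁻ _ e u) v)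
  ... | inj₁ u=v     = ==⇒≡ u v u=v
  ... | inj₂ σu≠σv = ⊥-elim (not-¬ (≡⇒== _ _ σu≡σv) (not-injective σu≠σv))

  isInjective⁺ : (σ : Vec (Fin n) n) → IsInjective σ → isInjective σ ≡ true
  isInjective⁺ σ inj = allV⁺ _ (λ u → allV⁺ _ (λ v → test u v))
    where
    test : ∀ u v → ((u == v) ∨ not (lookup σ u == lookup σ v)) ≡ true
    test u v with lookup σ u == lookup σ v in σu=σv
    ... | false = ∨-true⁺ʳ refl
    ... | true  rewrite ≡⇒== u v (inj (==⇒≡ _ _ σu=σv)) = refl

  ∈-permutations⁻ : {σ : Vec (Fin n) n} → σ ∈ permutations n → IsInjective σ
  ∈-permutations⁻ {σ} m = isInjective⁻ σ (proj₂ (∈-filterᵇ⁻ isInjective {allMaps n n} m))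

  ∈-permutations⁺ : (σ : Vec (Fin n) n) → IsInjective σ → σ ∈ permutations n
  ∈-permutations⁺ σ inj = ∈-filterᵇ⁺ isInjective (∈-allMaps n n σ) (isInjective⁺ σ inj)

  permutations-unique : Unique (permutations n)
  permutations-unique = Uniqueₚ.filter⁺ _ (allMaps-unique n n)

injective⇒surjective : ∀ {n} (f : Fin n → Fin n) → Injective _≡_ _≡_ f → ∀ b → ∃[ a ] f a ≡ b
injective⇒surjective {suc m} f f-inj b with Finₚ.any? (λ a → f a Finₚ.≟ b)
... | yes hit  = hit
... | no  miss = ⊥-elim (<-irrefl refl (Finₚ.injective⇒≤ g-inj))
  where
  g : Fin (suc m) → Fin m
  g a = Fin.punchOut {i = b} {j = f a} (λ b≡fa → miss (a , sym b≡fa))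
  g-inj : Injective _≡_ _≡_ g
  g-inj {a} {a′} ga≡ga′ = f-inj (Finₚ.punchOut-injective {i = b} {f a} {f a′} _ _ ga≡ga′)

module _ {n : ℕ} where

  infixr 9 _∘ᵛ_

  _∘ᵛ_ : Vec (Fin n) n → Vec (Fin n) n → Vec (Fin n) n
  σ ∘ᵛ τ = tabulate (lookup σ ∘ lookup τ)

  lookup-∘ᵛ : ∀ σ τ i → lookup (σ ∘ᵛ τ) i ≡ lookup σ (lookup τ i)
  lookup-∘ᵛ σ τ = Vecₚ.lookup∘tabulate _

  ∘ᵛ-injective : ∀ σ τ → IsInjective σ → IsInjective τ → IsInjective (σ ∘ᵛ τ)
  ∘ᵛ-injective σ τ σ-inj τ-inj e = τ-inj (σ-inj (trans (sym (lookup-∘ᵛ σ τ _)) (trans e (lookup-∘ᵛ σ τ _))))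

  ∘ᵛ-cancelˡ : ∀ σ {τ τ′} → IsInjective σ → σ ∘ᵛ τ ≡ σ ∘ᵛ τ′ → τ ≡ τ′
  ∘ᵛ-cancelˡ σ {τ} {τ′} σ-inj e = lookup-extensionality τ τ′ λ i →
    σ-inj (trans (sym (lookup-∘ᵛ σ τ i)) (trans (cong (λ ρ → lookup ρ i) e) (lookup-∘ᵛ σ τ′ i)))

  inverse : (σ : Vec (Fin n) n) → IsInjective σ → Vec (Fin n) n
  inverse σ inj = tabulate (λ b → proj₁ (injective⇒surjective (lookup σ) inj b))

  inverseʳ : ∀ σ (inj : IsInjective σ) b → lookup σ (lookup (inverse σ inj) b) ≡ b
  inverseʳ σ inj b = trans (cong (lookup σ) (Vecₚ.lookup∘tabulate _ b)) (proj₂ (injective⇒surjective (lookup σ) inj b))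

  inverse-injective : ∀ σ (inj : IsInjective σ) → IsInjective (inverse σ inj)
  inverse-injective σ inj {u} {v} e = trans (sym (inverseʳ σ inj u)) (trans (cong (lookup σ) e) (inverseʳ σ inj v))

module _ {n : ℕ} where

  elemᵛ : ∀ {m} → Fin n → Vec (Fin n) m → Bool
  elemᵛ x []ᵥ       = false
  elemᵛ x (y ∷ᵥ t) = (x == y) ∨ elemᵛ x t

  distinct : ∀ {m} → Vec (Fin n) m → Bool
  distinct []ᵥ       = true
  distinct (x ∷ᵥ t) = not (elemᵛ x t) ∧ distinct t

  elemᵛ⁻ : ∀ {m} x (t : Vec (Fin n) m) → elemᵛ x t ≡ true → ∃[ i ] lookup t i ≡ x
  elemᵛ⁻ x (y ∷ᵥ t) e with ∨-true⁻ {x == y} e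
  ... | inj₁ x=y = Fin.zero , sym (==⇒≡ x y x=y)
  ... | inj₂ x∈t = let i , ti≡x = elemᵛ⁻ x t x∈t in Fin.suc i , ti≡x

  elemᵛ⁺ : ∀ {m} x (t : Vec (Fin n) m) i → lookup t i ≡ x → elemᵛ x t ≡ true
  elemᵛ⁺ x (y ∷ᵥ t) Fin.zero    refl = cong (_∨ elemᵛ y t) (==-refl y)
  elemᵛ⁺ x (y ∷ᵥ t) (Fin.suc i) e    = ∨-true⁺ʳ (elemᵛ⁺ x t i e)

  distinct⁻ : ∀ {m} (t : Vec (Fin n) m) → distinct t ≡ true → IsInjective t
  distinct⁻ (x ∷ᵥ t) e {Fin.zero}  {Fin.zero}  _ = refl
  distinct⁻ (x ∷ᵥ t) e {Fin.zero}  {Fin.suc j} x≡tj = ⊥-elim (not-¬ (elemᵛ⁺ x t j (sym x≡tj)) (not-injective (∧-conicalˡ _ _ e)))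
  distinct⁻ (x ∷ᵥ t) e {Fin.suc i} {Fin.zero}  ti≡x = ⊥-elim (not-¬ (elemᵛ⁺ x t i ti≡x) (not-injective (∧-conicalˡ _ _ e)))
  distinct⁻ (x ∷ᵥ t) e {Fin.suc i} {Fin.suc j} ti≡tj = cong Fin.suc (distinct⁻ t (∧-conicalʳ _ _ e) ti≡tj)

  distinct⁺ : ∀ {m} (t : Vec (Fin n) m) → IsInjective t → distinct t ≡ true
  distinct⁺ []ᵥ       _   = refl
  distinct⁺ (x ∷ᵥ t) inj = ∧-true⁺ (cong not (¬-not x∉t)) (distinct⁺ t (Finₚ.suc-injective ∘ inj))
    where
    x∉t : elemᵛ x t ≢ true
    x∉t x∈t with i , ti≡x ← elemᵛ⁻ x t x∈t with () ← inj {Fin.zero} {Fin.suc i} (sym ti≡x)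

  count-elemᵛ : ∀ {m} (t : Vec (Fin n) m) → distinct t ≡ true → count (λ x → elemᵛ x t) (allFin n) ≡ m
  count-elemᵛ []ᵥ       _ = sumBy-zero (allFin n)
  count-elemᵛ (y ∷ᵥ t) e = begin
    count (λ x → (x == y) ∨ elemᵛ x t) (allFin n)              ≡⟨ count-∨ _ _ (allFin n) y∉t ⟩
    count (_== y) (allFin n) + count (λ x → elemᵛ x t) (allFin n) ≡⟨ cong₂ _+_ (count-== y) (count-elemᵛ t (∧-conicalʳ _ _ e)) ⟩
    suc _                                                        ∎
    where
    open ≡-Reasoning
    y∉t : ∀ {x} → (x == y) ≡ true → elemᵛ x t ≡ false
    y∉t {x} x=y rewrite ==⇒≡ x y x=y = not-injective (∧-conicalˡ _ _ e)

  count-distinct : ∀ m → count distinct (allMaps n m) ≡ n P′ m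
  count-distinct zero    = refl
  count-distinct (suc m) = begin
    count distinct (concatMap (λ x → map (x ∷ᵥ_) (allMaps n m)) (allFin n))
      ≡⟨ sumBy-concatMap _ _ (allFin n) ⟩
    sumBy (λ x → count distinct (map (x ∷ᵥ_) (allMaps n m))) (allFin n)
      ≡⟨ sumBy-cong _ _ (allFin n) (λ x _ → sumBy-map _ (x ∷ᵥ_) (allMaps n m)) ⟩
    sumBy (λ x → sumBy (λ t → indicator (distinct (x ∷ᵥ t))) (allMaps n m)) (allFin n)
      ≡⟨ sumBy-comm (λ x t → indicator (distinct (x ∷ᵥ t))) (allFin n) (allMaps n m) ⟩
    sumBy (λ t → count (λ x → distinct (x ∷ᵥ t)) (allFin n)) (allMaps n m)
      ≡⟨ sumBy-cong _ _ (allMaps n m) (λ t _ → heads t) ⟩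
    sumBy (λ t → indicator (distinct t) * (n ∸ m)) (allMaps n m)
      ≡⟨ sumBy-*ʳ _ (n ∸ m) (allMaps n m) ⟩
    count distinct (allMaps n m) * (n ∸ m)
      ≡⟨ cong (_* (n ∸ m)) (count-distinct m) ⟩
    (n P′ m) * (n ∸ m)
      ≡⟨ *-comm (n P′ m) (n ∸ m) ⟩
    n P′ suc m ∎
    where
    open ≡-Reasoning
    heads : (t : Vec (Fin n) m) → count (λ x → distinct (x ∷ᵥ t)) (allFin n) ≡ indicator (distinct t) * (n ∸ m)
    heads t with distinct t in dt
    ... | false = trans (count-cong _ _ (allFin n) (λ x _ → ∧-zeroʳ _)) (sumBy-zero (allFin n))
    ... | true  = trans (count-cong _ _ (allFin n) (λ x _ → ∧-identityʳ _))
                        (trans (count-complement (λ x → elemᵛ x t) m (count-elemᵛ t dt)) (sym (+-identityʳ _)))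

  length-permutations : length (permutations n) ≡ n !
  length-permutations = begin
    length (filterᵇ isInjective (allMaps n n)) ≡⟨ length-filterᵇ isInjective (allMaps n n) ⟩
    count isInjective (allMaps n n)             ≡⟨ count-cong _ _ (allMaps n n) (λ σ _ → isInjective≡distinct σ) ⟩
    count distinct (allMaps n n)                ≡⟨ count-distinct n ⟩
    n P′ n                                      ≡⟨ nP′n≡n! n ⟩
    n !                                         ∎
    where
    open ≡-Reasoning
    isInjective≡distinct : (σ : Vec (Fin n) n) → isInjective σ ≡ distinct σ
    isInjective≡distinct σ = ⇔→≡ (mk⇔ (distinct⁺ σ ∘ isInjective⁻ σ) (isInjective⁺ σ ∘ distinct⁻ σ))

-- Copies and labelled embeddings

module EquivalenceClasses (_≈ᵇ_ : A → A → Bool)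
  (≈-refl  : ∀ x → (x ≈ᵇ x) ≡ true)
  (≈-sym   : ∀ {x y} → (x ≈ᵇ y) ≡ true → (y ≈ᵇ x) ≡ true)
  (≈-trans : ∀ {x y z} → (x ≈ᵇ y) ≡ true → (y ≈ᵇ z) ≡ true → (x ≈ᵇ z) ≡ true) where

  decSetoid : DecSetoid _ _
  decSetoid = record
    { Carrier = A
    ; _≈_ = λ x y → T (x ≈ᵇ y)
    ; isDecEquivalence = record
      { isEquivalence = record
        { refl  = ≡true⇒T (≈-refl _)
        ; sym   = ≡true⇒T ∘ ≈-sym ∘ T⇒≡true
        ; trans = λ x≈y y≈z → ≡true⇒T (≈-trans (T⇒≡true x≈y) (T⇒≡true y≈z))
        }
      ; _≟_ = λ x y → T? (x ≈ᵇ y)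
      }
    }

  open UniqueDS decSetoid using () renaming (Unique to Separated)

  separated-count-≤1 : ∀ {D} → Separated D → ∀ x → count (_≈ᵇ x) D ≤ 1
  separated-count-≤1 {[]}    _              x = z≤n
  separated-count-≤1 {y ∷ D} (y≉D ∷ sepD) x with y ≈ᵇ x in y≈x
  ... | false = separated-count-≤1 sepD x
  ... | true  = s≤s (≤-reflexive (none y≉D))
    where
    none : ∀ {E} → All (λ z → ¬ T (y ≈ᵇ z)) E → count (_≈ᵇ x) E ≡ 0
    none {[]}    []            = refl
    none {z ∷ E} (y≉z ∷ y≉E) with z ≈ᵇ x in z≈x
    ... | true  = ⊥-elim (y≉z (≡true⇒T (≈-trans y≈x (≈-sym z≈x))))
    ... | false = none y≉E

  double-count : ∀ D M → sumBy (λ y → count (y ≈ᵇ_) M) D ≡ sumBy (λ x → count (_≈ᵇ x) D) M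
  double-count D M = sumBy-comm (λ y x → indicator (y ≈ᵇ x)) D M

  classes : List A → List A
  classes = deduplicateᵇ _≈ᵇ_

  classes-⊆ : ∀ M {y} → y ∈ classes M → y ∈ M
  classes-⊆ M = ∈-deduplicate⁻ (λ x y → T? (x ≈ᵇ y)) M

  classes-cover : ∀ {M x} → x ∈ M → ∃[ y ] y ∈ classes M × (y ≈ᵇ x) ≡ true
  classes-cover {M} {x} x∈M = let y , y∈D , y≈x = find representative in y , y∈D , T⇒≡true y≈x
    where
    resp : ∀ {y z} → T (z ≈ᵇ y) → T (y ≈ᵇ x) → T (z ≈ᵇ x)
    resp z≈y y≈x = ≡true⇒T (≈-trans (T⇒≡true z≈y) (T⇒≡true y≈x))
    representative : Any (λ y → T (y ≈ᵇ x)) (classes M)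
    representative = Anyₚ.deduplicate⁺ (λ x y → T? (x ≈ᵇ y)) resp (Any.map (λ { refl → ≡true⇒T (≈-refl x) }) x∈M)

  length-classes-*-≤ : ∀ M m → (∀ {y} → y ∈ M → m ≤ count (y ≈ᵇ_) M) → length (classes M) * m ≤ length M
  length-classes-*-≤ M m large = begin
    length (classes M) * m                        ≡⟨ sumBy-const m (classes M) ⟨
    sumBy (λ _ → m) (classes M)                   ≤⟨ sumBy-mono _ _ (classes M) (λ y y∈D → large (classes-⊆ M y∈D)) ⟩
    sumBy (λ y → count (y ≈ᵇ_) M) (classes M)     ≡⟨ double-count (classes M) M ⟩
    sumBy (λ x → count (_≈ᵇ x) (classes M)) M     ≤⟨ sumBy-mono _ _ M (λ x _ → separated-count-≤1 (deduplicate-! decSetoid M) x) ⟩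
    sumBy (λ _ → 1) M                             ≡⟨ sumBy-const 1 M ⟩
    length M * 1                                  ≡⟨ *-identityʳ _ ⟩
    length M                                      ∎
    where open ≤-Reasoning

  length-≤-classes-* : ∀ M m → (∀ {y} → y ∈ M → count (y ≈ᵇ_) M ≤ m) → length M ≤ length (classes M) * m
  length-≤-classes-* M m small = begin
    length M                                      ≡⟨ *-identityʳ _ ⟨
    length M * 1                                  ≡⟨ sumBy-const 1 M ⟨
    sumBy (λ _ → 1) M                             ≤⟨ sumBy-mono _ _ M (λ x x∈M → covered x∈M) ⟩
    sumBy (λ x → count (_≈ᵇ x) (classes M)) M     ≡⟨ double-count (classes M) M ⟨
    sumBy (λ y → count (y ≈ᵇ_) M) (classes M)     ≤⟨ sumBy-mono _ _ (classes M) (λ y y∈D → small (classes-⊆ M y∈D)) ⟩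
    sumBy (λ _ → m) (classes M)                   ≡⟨ sumBy-const m (classes M) ⟩
    length (classes M) * m                        ∎
    where
    open ≤-Reasoning
    covered : ∀ {x} → x ∈ M → 1 ≤ count (_≈ᵇ x) (classes M)
    covered {x} x∈M = let y , y∈D , y≈x = classes-cover x∈M in count-≥1 (_≈ᵇ x) y∈D y≈x

module _ {n : ℕ} where

  sameGraph⁻ : (G G′ : Graph n) → sameGraph G G′ ≡ true → ∀ a b → G a b ≡ G′ a b
  sameGraph⁻ G G′ e a b = xor-false (G a b) (G′ a b) (not-injective (allV⁻ _ (allV⁻ _ e a) b))
    where
    xor-false : ∀ x y → x xor y ≡ false → x ≡ y
    xor-false true  true  _ = refl
    xor-false false false _ = refl

  sameGraph⁺ : (G G′ : Graph n) → (∀ a b → G a b ≡ G′ a b) → sameGraph G G′ ≡ true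
  sameGraph⁺ G G′ h = allV⁺ _ (λ a → allV⁺ _ (λ b → cong not (subst (λ y → G a b xor y ≡ false) (h a b) (xor-same (G a b)))))

  subGraphᵇ⁻ : (G G′ : Graph n) → subGraphᵇ G G′ ≡ true → G ⊆ᴳ G′
  subGraphᵇ⁻ G G′ e a b Gab with ∨-true⁻ (allV⁻ _ (allV⁻ _ e a) b)
  ... | inj₁ ¬Gab = ⊥-elim (not-¬ Gab (not-injective ¬Gab))
  ... | inj₂ G′ab = G′ab

  subGraphᵇ⁺ : (G G′ : Graph n) → G ⊆ᴳ G′ → subGraphᵇ G G′ ≡ true
  subGraphᵇ⁺ G G′ G⊆G′ = allV⁺ _ (λ a → allV⁺ _ (λ b → test a b))
    where
    test : ∀ a b → (not (G a b) ∨ G′ a b) ≡ true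
    test a b with G a b in Gab
    ... | true  = G⊆G′ a b Gab
    ... | false = refl

  open EquivalenceClasses (sameGraph {n})
    (λ G → sameGraph⁺ G G (λ _ _ → refl))
    (λ {G} {G′} e → sameGraph⁺ G′ G (λ a b → sym (sameGraph⁻ G G′ e a b)))
    (λ {G} {G′} {G″} e e′ → sameGraph⁺ G G″ (λ a b → trans (sameGraph⁻ G G′ e a b) (sameGraph⁻ G′ G″ e′ a b)))

  count-permutations-≤ : (p q : Vec (Fin n) n → Bool) (f : Vec (Fin n) n → Vec (Fin n) n) → Injective _≡_ _≡_ f →
                         (∀ {τ} → IsInjective τ → p τ ≡ true → IsInjective (f τ) × q (f τ) ≡ true) →
                         count p (permutations n) ≤ count q (permutations n)
  count-permutations-≤ p q f f-inj maps = subst₂ _≤_ (length-filterᵇ p (permutations n)) (length-filterᵇ q (permutations n))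
    (injection⇒length≤ f f-inj (Uniqueₚ.filter⁺ _ permutations-unique) image∈)
    where
    image∈ : ∀ {τ} → τ ∈ filterᵇ p (permutations n) → f τ ∈ filterᵇ q (permutations n)
    image∈ τ∈ = let τ∈P , pτ = ∈-filterᵇ⁻ p {permutations n} τ∈
                    fτ-inj , qfτ = maps (∈-permutations⁻ τ∈P) pτ
                in ∈-filterᵇ⁺ q (∈-permutations⁺ _ fτ-inj) qfτ

  pullback : Vec (Fin n) n → Graph n → Graph n
  pullback τ G u v = G (lookup τ u) (lookup τ v)

  module Embeddings (F : Graph n) where

    embeddings : Graph n → ℕ
    embeddings G = count (λ σ → subGraphᵇ (image σ F) G) (permutations n)

    automorphisms : ℕ
    automorphisms = count (λ τ → sameGraph F (image τ F)) (permutations n)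

    image-pullback : ∀ σ → IsInjective σ → ∀ u v → pullback σ (image σ F) u v ≡ F u v
    image-pullback σ σ-inj u v = ⇔→≡ (mk⇔ to from)
      where
      witness : Fin n → Fin n → Bool
      witness u′ v′ = (lookup σ u′ == lookup σ u) ∧ (lookup σ v′ == lookup σ v) ∧ F u′ v′
      to : image σ F (lookup σ u) (lookup σ v) ≡ true → F u v ≡ true
      to e with u′ , e′ ← anyV⁻ (λ u′ → anyV (witness u′)) e with v′ , w ← anyV⁻ (witness u′) e′ =
        let σu′=σu , rest = ∧-true⁻ (lookup σ u′ == lookup σ u) _ w
            σv′=σv , Fu′v′ = ∧-true⁻ (lookup σ v′ == lookup σ v) _ rest
        in subst₂ (λ x y → F x y ≡ true) (σ-inj (==⇒≡ _ _ σu′=σu)) (σ-inj (==⇒≡ _ _ σv′=σv)) Fu′v′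
      from : F u v ≡ true → image σ F (lookup σ u) (lookup σ v) ≡ true
      from Fuv = anyV⁺ _ u (anyV⁺ (witness u) v (∧-true⁺ (==-refl (lookup σ u)) (∧-true⁺ (==-refl (lookup σ v)) Fuv)))

    image≡pullback-inverse : ∀ σ (σ-inj : IsInjective σ) a b → image σ F a b ≡ pullback (inverse σ σ-inj) F a b
    image≡pullback-inverse σ σ-inj a b =
      trans (sym (cong₂ (image σ F) (inverseʳ σ σ-inj a) (inverseʳ σ σ-inj b))) (image-pullback σ σ-inj _ _)

    sameGraph-image⁻ : ∀ G τ → IsInjective τ → sameGraph G (image τ F) ≡ true → ∀ u v → pullback τ G u v ≡ F u v
    sameGraph-image⁻ G τ τ-inj e u v = trans (sameGraph⁻ G (image τ F) e _ _) (image-pullback τ τ-inj u v)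

    sameGraph-image⁺ : ∀ G τ (τ-inj : IsInjective τ) → (∀ u v → pullback τ G u v ≡ F u v) → sameGraph G (image τ F) ≡ true
    sameGraph-image⁺ G τ τ-inj h = sameGraph⁺ G (image τ F) λ a b →
      trans (sym (cong₂ G (inverseʳ τ τ-inj a) (inverseʳ τ τ-inj b)))
            (trans (h _ _) (sym (image≡pullback-inverse τ τ-inj a b)))

    fibre : Vec (Fin n) n → ℕ
    fibre σ = count (λ τ → sameGraph (image σ F) (image τ F)) (permutations n)

    fibre≡automorphisms : ∀ σ → IsInjective σ → fibre σ ≡ automorphisms
    fibre≡automorphisms σ σ-inj = ≤-antisym
      (count-permutations-≤ _ _ (σ⁻¹ ∘ᵛ_) (∘ᵛ-cancelˡ σ⁻¹ (inverse-injective σ σ-inj)) λ {ρ} ρ-inj σF≈ρF →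
        let σ⁻¹ρ-inj = ∘ᵛ-injective σ⁻¹ ρ (inverse-injective σ σ-inj) ρ-inj
        in σ⁻¹ρ-inj , sameGraph-image⁺ F (σ⁻¹ ∘ᵛ ρ) σ⁻¹ρ-inj λ u v → begin
          F (lookup (σ⁻¹ ∘ᵛ ρ) u) (lookup (σ⁻¹ ∘ᵛ ρ) v)     ≡⟨ cong₂ F (lookup-∘ᵛ σ⁻¹ ρ u) (lookup-∘ᵛ σ⁻¹ ρ v) ⟩
          pullback σ⁻¹ F (lookup ρ u) (lookup ρ v)           ≡⟨ image≡pullback-inverse σ σ-inj _ _ ⟨
          pullback ρ (image σ F) u v                         ≡⟨ sameGraph-image⁻ (image σ F) ρ ρ-inj σF≈ρF u v ⟩
          F u v                                              ∎)
      (count-permutations-≤ _ _ (σ ∘ᵛ_) (∘ᵛ-cancelˡ σ σ-inj) λ {τ} τ-inj F≈τF →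
        let στ-inj = ∘ᵛ-injective σ τ σ-inj τ-inj
        in στ-inj , sameGraph-image⁺ (image σ F) (σ ∘ᵛ τ) στ-inj λ u v → begin
          image σ F (lookup (σ ∘ᵛ τ) u) (lookup (σ ∘ᵛ τ) v)  ≡⟨ cong₂ (image σ F) (lookup-∘ᵛ σ τ u) (lookup-∘ᵛ σ τ v) ⟩
          pullback σ (image σ F) (lookup τ u) (lookup τ v)   ≡⟨ image-pullback σ σ-inj _ _ ⟩
          pullback τ F u v                                   ≡⟨ sameGraph-image⁻ F τ τ-inj F≈τF u v ⟩
          F u v                                              ∎)
      where
      open ≡-Reasoning
      σ⁻¹ : Vec (Fin n) n
      σ⁻¹ = inverse σ σ-inj

    images : List (Graph n)
    images = map (λ σ → image σ F) (permutations n)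

    imageCopies : Graph n → List (Graph n)
    imageCopies G = filterᵇ (λ F′ → subGraphᵇ F′ G) images

    length-imageCopies : ∀ G → length (imageCopies G) ≡ embeddings G
    length-imageCopies G = trans (length-filterᵇ (λ F′ → subGraphᵇ F′ G) images)
                                 (sumBy-map (indicator ∘ λ F′ → subGraphᵇ F′ G) (λ σ → image σ F) (permutations n))

    count-imageCopies : ∀ G σ → count (sameGraph (image σ F)) (imageCopies G)
                               ≡ count (λ τ → subGraphᵇ (image τ F) G ∧ sameGraph (image σ F) (image τ F)) (permutations n)
    count-imageCopies G σ = trans (count-filterᵇ (sameGraph (image σ F)) (λ F′ → subGraphᵇ F′ G) images)
                                  (sumBy-map _ (λ σ → image σ F) (permutations n))

    ∈-imageCopies⁻ : ∀ G {F′} → F′ ∈ imageCopies G → ∃[ σ ] σ ∈ permutations n × F′ ≡ image σ F × subGraphᵇ F′ G ≡ true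
    ∈-imageCopies⁻ G F′∈ with F′∈images , F′⊆G ← ∈-filterᵇ⁻ _ {images} F′∈
                         with σ , σ∈P , refl ← ∈-map⁻ _ F′∈images = σ , σ∈P , refl , F′⊆G

    copies-*-automorphisms-≤ : ∀ G → copies F G * automorphisms ≤ embeddings G
    copies-*-automorphisms-≤ G = subst (copies F G * automorphisms ≤_) (length-imageCopies G)
      (length-classes-*-≤ (imageCopies G) automorphisms large)
      where
      large : ∀ {F′} → F′ ∈ imageCopies G → automorphisms ≤ count (sameGraph F′) (imageCopies G)
      large F′∈ with σ , σ∈P , refl , σF⊆G ← ∈-imageCopies⁻ G F′∈ = begin
        automorphisms   ≡⟨ fibre≡automorphisms σ (∈-permutations⁻ σ∈P) ⟨
        fibre σ         ≤⟨ count-mono _ _ (permutations n) (λ τ _ σF≈τF → ∧-true⁺ (τF⊆G τ σF≈τF) σF≈τF) ⟩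
        count (λ τ → subGraphᵇ (image τ F) G ∧ sameGraph (image σ F) (image τ F)) (permutations n)
                        ≡⟨ count-imageCopies G σ ⟨
        count (sameGraph (image σ F)) (imageCopies G) ∎
        where
        open ≤-Reasoning
        τF⊆G : ∀ τ → sameGraph (image σ F) (image τ F) ≡ true → subGraphᵇ (image τ F) G ≡ true
        τF⊆G τ σF≈τF = subGraphᵇ⁺ (image τ F) G λ a b τFab →
          subGraphᵇ⁻ (image σ F) G σF⊆G a b (trans (sameGraph⁻ (image σ F) (image τ F) σF≈τF a b) τFab)

    n!-≤-copies-*-automorphisms : ∀ G → (∀ σ → IsInjective σ → image σ F ⊆ᴳ G) → n ! ≤ copies F G * automorphisms
    n!-≤-copies-*-automorphisms G all⊆G = begin
      n !                          ≡⟨ length-permutations {n} ⟨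
      length (permutations n)      ≡⟨ all-embed ⟨
      embeddings G                 ≡⟨ length-imageCopies G ⟨
      length (imageCopies G)       ≤⟨ length-≤-classes-* (imageCopies G) automorphisms small ⟩
      copies F G * automorphisms   ∎
      where
      open ≤-Reasoning
      all-embed : embeddings G ≡ length (permutations n)
      all-embed = begin-equality
        embeddings G                        ≡⟨ count-cong _ (λ _ → true) _ (λ σ σ∈P →
                                                 subGraphᵇ⁺ (image σ F) G (all⊆G σ (∈-permutations⁻ σ∈P))) ⟩
        sumBy (λ _ → 1) (permutations n)    ≡⟨ sumBy-const 1 (permutations n) ⟩
        length (permutations n) * 1         ≡⟨ *-identityʳ _ ⟩
        length (permutations n)             ∎
      small : ∀ {F′} → F′ ∈ imageCopies G → count (sameGraph F′) (imageCopies G) ≤ automorphisms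
      small F′∈ with σ , σ∈P , refl , _ ← ∈-imageCopies⁻ G F′∈ = begin
        count (sameGraph (image σ F)) (imageCopies G) ≡⟨ count-imageCopies G σ ⟩
        count (λ τ → subGraphᵇ (image τ F) G ∧ sameGraph (image σ F) (image τ F)) (permutations n)
                                                      ≤⟨ count-mono _ _ (permutations n) (λ τ _ → ∧-conicalʳ (subGraphᵇ (image τ F) G) _) ⟩
        fibre σ                                       ≡⟨ fibre≡automorphisms σ (∈-permutations⁻ σ∈P) ⟩
        automorphisms                                 ∎

    image⊆Complete : Loopless F → ∀ σ → IsInjective σ → image σ F ⊆ᴳ Complete n
    image⊆Complete loopless σ σ-inj a b σFab = cong not (≢⇒==-false a b a≢b)
      where
      a≢b : a ≢ b
      a≢b refl = not-¬ (trans (sym (image≡pullback-inverse σ σ-inj a a)) σFab) (loopless _)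

    copies-ratio : Loopless F → ∀ G → copies F G * n ! ≤ embeddings G * copies F (Complete n)
    copies-ratio loopless G = begin
      copies F G * n !                                    ≤⟨ *-monoʳ-≤ (copies F G) (n!-≤-copies-*-automorphisms (Complete n) (image⊆Complete loopless)) ⟩
      copies F G * (copies F (Complete n) * automorphisms) ≡⟨ *-Semigroupₚ.x∙yz≈xz∙y (copies F G) _ automorphisms ⟩
      copies F G * automorphisms * copies F (Complete n)  ≤⟨ *-monoˡ-≤ (copies F (Complete n)) (copies-*-automorphisms-≤ G) ⟩
      embeddings G * copies F (Complete n)                ∎
      where open ≤-Reasoning

-- Connectivity

least : ∀ {m} (p : Fin m → Bool) {w} → p w ≡ true →
        Σ (Fin m) λ u → p u ≡ true × (∀ x → toℕ x < toℕ u → p x ≡ false)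
least {m} p {w} pw with u , pu≢false , below ← Finₚ.¬∀⟶∃¬-smallest m (λ x → p x ≡ false) (λ x → p x Bool.≟ false) (λ all → not-¬ pw (all w))
  = u , ¬-not pu≢false , λ x x<u → subst (λ y → p y ≡ false) (inject-fromℕ< x x<u) (below (Fin.fromℕ< x<u))
  where
  inject-fromℕ< : ∀ x (x<u : toℕ x < toℕ u) → Fin.inject {i = u} (Fin.fromℕ< x<u) ≡ x
  inject-fromℕ< x x<u = Finₚ.toℕ-injective (trans (Finₚ.toℕ-inject (Fin.fromℕ< x<u)) (Finₚ.toℕ-fromℕ< x<u))

leastℕ : (p : ℕ → Bool) {w : ℕ} → p w ≡ true → Σ ℕ λ d → d ≤ w × p d ≡ true × (∀ t → t < d → p t ≡ false)
leastℕ p {w} pw with d , pd , below ← least (p ∘ toℕ) {Fin.fromℕ w} (subst (λ t → p t ≡ true) (sym (Finₚ.toℕ-fromℕ w)) pw)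
  = toℕ d , s≤s⁻¹ (Finₚ.toℕ<n d) , pd , λ t t<d → below′ t (<-trans t<d (Finₚ.toℕ<n d)) t<d
  where
  below′ : ∀ t (t<1+w : t < suc w) → t < toℕ d → p t ≡ false
  below′ t t<1+w t<d = subst (λ i → p i ≡ false) (Finₚ.toℕ-fromℕ< t<1+w)
                             (below (Fin.fromℕ< t<1+w) (subst (_< toℕ d) (sym (Finₚ.toℕ-fromℕ< t<1+w)) t<d))

module Reachability {n : ℕ} (F : Graph n) (F-sym : Symmetric F) where

  reach : ℕ → Fin n → Fin n → Bool
  reach = reachWithin F

  reach-suc : ∀ t {u v} → reach t u v ≡ true → reach (suc t) u v ≡ true
  reach-suc t {u} {v} r = cong (_∨ anyV (λ w → reach t u w ∧ F w v)) r

  reach-mono : ∀ {t s u v} → t ≤ s → reach t u v ≡ true → reach s u v ≡ true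
  reach-mono {t} {s} {u} {v} t≤s r with j , refl ← m≤n⇒∃[o]m+o≡n t≤s = go j
    where
    go : ∀ j → reach (t + j) u v ≡ true
    go zero    = subst (λ i → reach i u v ≡ true) (sym (+-identityʳ t)) r
    go (suc j) = subst (λ i → reach i u v ≡ true) (sym (+-suc t j)) (reach-suc (t + j) (go j))

  reach-step : ∀ t {u w v} → reach t u w ≡ true → F w v ≡ true → reach (suc t) u v ≡ true
  reach-step t {u} {w} {v} r Fwv = ∨-true⁺ʳ {reach t u v} (anyV⁺ _ w (∧-true⁺ r Fwv))

  reach-suc⁻ : ∀ t {u v} → reach (suc t) u v ≡ true → reach t u v ≡ true ⊎ ∃[ w ] reach t u w ≡ true × F w v ≡ true
  reach-suc⁻ t {u} {v} r with ∨-true⁻ {reach t u v} r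
  ... | inj₁ r′ = inj₁ r′
  ... | inj₂ r′ = let w , rw = anyV⁻ (λ w → reach t u w ∧ F w v) r′ in inj₂ (w , ∧-true⁻ (reach t u w) _ rw)

  reach-trans : ∀ s t {u w v} → reach s u w ≡ true → reach t w v ≡ true → reach (s + t) u v ≡ true
  reach-trans s zero    {u} {w} {v} r r′ = subst₂ (λ i x → reach i u x ≡ true) (sym (+-identityʳ s)) (==⇒≡ w v r′) r
  reach-trans s (suc t) {u} {v = v} r r′ with reach-suc⁻ t r′
  ... | inj₁ r″            = subst (λ i → reach i u v ≡ true) (sym (+-suc s t)) (reach-suc (s + t) (reach-trans s t r r″))
  ... | inj₂ (x , r″ , Fxv) = subst (λ i → reach i u v ≡ true) (sym (+-suc s t)) (reach-step (s + t) (reach-trans s t r r″) Fxv)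

  reach-refl : ∀ t u → reach t u u ≡ true
  reach-refl t u = reach-mono {0} {t} {u} {u} z≤n (==-refl u)

  reach-sym : ∀ t {u v} → reach t u v ≡ true → reach t v u ≡ true
  reach-sym zero    {u} {v} r = subst (λ x → reach 0 x u ≡ true) (==⇒≡ u v r) (==-refl u)
  reach-sym (suc t) {u} {v} r with reach-suc⁻ t r
  ... | inj₁ r′              = reach-suc t (reach-sym t r′)
  ... | inj₂ (w , r′ , Fwv) = reach-trans 1 t (reach-step 0 {v} (==-refl v) (trans (F-sym v w) Fwv)) (reach-sym t r′)

  -- Until the set of vertices reachable from u in t steps stops changing, it gains a vertex with each step;
  -- so it is stable after n steps, and every reachable vertex is reachable in n steps.
  module _ (u : Fin n) where

    reachable : ℕ → ℕ
    reachable t = count (reach t u) (allFin n)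

    Stable : ℕ → Set
    Stable t = ∀ v → reach (suc t) u v ≡ true → reach t u v ≡ true

    stable-suc : ∀ {t} → Stable t → Stable (suc t)
    stable-suc {t} st v r with reach-suc⁻ (suc t) r
    ... | inj₁ r′              = r′
    ... | inj₂ (w , r′ , Fwv) = reach-step t (st w r′) Fwv

    stable-+ : ∀ {t} → Stable t → ∀ j v → reach (j + t) u v ≡ true → reach t u v ≡ true
    stable-+     st zero    v r = r
    stable-+ {t} st (suc j) v r = stable-+ st j v (stable-from j v r)
      where
      stable-from : ∀ j → Stable (j + t)
      stable-from zero    = st
      stable-from (suc j) = stable-suc {j + t} (stable-from j)

    stable-or-grows : ∀ t → Stable t ⊎ reachable t < reachable (suc t)
    stable-or-grows t with Finₚ.any? (λ v → (reach (suc t) u v ∧ not (reach t u v)) Bool.≟ true)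
    ... | yes (v , new) = let r′ , ¬r = ∧-true⁻ (reach (suc t) u v) _ new
                          in inj₂ (count-< _ _ (allFin n) (λ _ _ → reach-suc t) (∈-allFin v) r′ (not-injective ¬r))
    ... | no  none      = inj₁ old
      where
      old : Stable t
      old v r = ¬-not λ r′ → none (v , subst₂ (λ a b → a ∧ not b ≡ true) (sym r) (sym r′) refl)

    stable-before-or-grows : ∀ t → (∃[ s ] s ≤ t × Stable s) ⊎ t < reachable t
    stable-before-or-grows zero = inj₂ (count-≥1 (reach 0 u) (∈-allFin u) (==-refl u))
    stable-before-or-grows (suc t) with stable-before-or-grows t
    ... | inj₁ (s , s≤t , st) = inj₁ (s , m≤n⇒m≤1+n s≤t , st)
    ... | inj₂ t<reachable with stable-or-grows t
    ...   | inj₁ st     = inj₁ (t , n≤1+n t , st)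
    ...   | inj₂ grows  = inj₂ (≤-<-trans t<reachable grows)

    reach⇒connected : ∀ t {v} → reach t u v ≡ true → Connected F u v ≡ true
    reach⇒connected t {v} r with stable-before-or-grows n
    ... | inj₂ n<reachable   = ⊥-elim (<-irrefl refl (<-≤-trans n<reachable (count-allFin-≤ (reach n u))))
    ... | inj₁ (s , s≤n , st) with t ≤? s
    ...   | yes t≤s = reach-mono s≤n (reach-mono t≤s r)
    ...   | no  t≰s = reach-mono s≤n (stable-+ st (t ∸ s) v (subst (λ i → reach i u v ≡ true) (sym (m∸n+n≡m (<⇒≤ (≰⇒> t≰s)))) r))

  connected-refl : ∀ u → Connected F u u ≡ true
  connected-refl u = reach-refl n u

  connected-sym : ∀ {u v} → Connected F u v ≡ true → Connected F v u ≡ true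
  connected-sym = reach-sym n

  connected-trans : ∀ {u w v} → Connected F u w ≡ true → Connected F w v ≡ true → Connected F u v ≡ true
  connected-trans {u} c c′ = reach⇒connected u (n + n) (reach-trans n n c c′)

  edge⇒connected : ∀ {u v} → F u v ≡ true → Connected F u v ≡ true
  edge⇒connected {u} Fuv = reach⇒connected u 1 (reach-step 0 {u} (==-refl u) Fuv)

count-partition : ∀ {n} (p : Fin n → Bool) (g : Fin n → Fin n) →
                  count p (allFin n) ≡ sumBy (λ w → count (λ v → p v ∧ (g v == w)) (allFin n)) (allFin n)
count-partition {n} p g = begin
  count p (allFin n)                                                   ≡⟨ sumBy-cong _ _ (allFin n) (λ v _ → fibre v) ⟨
  sumBy (λ v → count (λ w → p v ∧ (g v == w)) (allFin n)) (allFin n)   ≡⟨ sumBy-comm (λ v w → indicator (p v ∧ (g v == w))) (allFin n) (allFin n) ⟩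
  sumBy (λ w → count (λ v → p v ∧ (g v == w)) (allFin n)) (allFin n)   ∎
  where
  open ≡-Reasoning
  fibre : ∀ v → count (λ w → p v ∧ (g v == w)) (allFin n) ≡ indicator (p v)
  fibre v with p v
  ... | false = sumBy-zero (allFin n)
  ... | true  = trans (count-cong _ _ (allFin n) (λ w _ → ==-sym (g v) w)) (count-== (g v))

module Components {n : ℕ} (F : Graph n) (F-sym : Symmetric F) (F-loopless : Loopless F) where
  open Reachability F F-sym public

  private
    rootΣ : ∀ v → Σ (Fin n) λ u → Connected F u v ≡ true × (∀ x → toℕ x < toℕ u → Connected F x v ≡ false)
    rootΣ v = least (λ u → Connected F u v) (connected-refl v)

  root : Fin n → Fin n
  root v = proj₁ (rootΣ v)

  root-connected : ∀ v → Connected F (root v) v ≡ true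
  root-connected v = proj₁ (proj₂ (rootΣ v))

  root-minimal : ∀ v x → toℕ x < toℕ (root v) → Connected F x v ≡ false
  root-minimal v = proj₂ (proj₂ (rootΣ v))

  root-≤ : ∀ v → toℕ (root v) ≤ toℕ v
  root-≤ v = ≮⇒≥ λ v<root → not-¬ (connected-refl v) (root-minimal v v v<root)

  root-cong : ∀ {u v} → Connected F u v ≡ true → root u ≡ root v
  root-cong {u} {v} c with <-cmp (toℕ (root u)) (toℕ (root v))
  ... | tri< ru<rv _ _ = ⊥-elim (not-¬ (connected-trans (root-connected u) c) (root-minimal v (root u) ru<rv))
  ... | tri≈ _ ru≡rv _ = Finₚ.toℕ-injective ru≡rv
  ... | tri> _ _ rv<ru = ⊥-elim (not-¬ (connected-trans (root-connected v) (connected-sym c)) (root-minimal u (root v) rv<ru))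

  isRoot : Fin n → Bool
  isRoot v = allV (λ u → not ((toℕ u <ᵇ toℕ v) ∧ Connected F u v))

  isRoot⁻ : ∀ v → isRoot v ≡ true → root v ≡ v
  isRoot⁻ v e = Finₚ.toℕ-injective (≤-antisym (root-≤ v) (≮⇒≥ root<v))
    where
    root<v : ¬ toℕ (root v) < toℕ v
    root<v lt = not-¬ (∧-true⁺ (T⇒≡true (<⇒<ᵇ lt)) (root-connected v)) (not-injective (allV⁻ _ e (root v)))

  isRoot⁺ : ∀ v → root v ≡ v → isRoot v ≡ true
  isRoot⁺ v root≡v = allV⁺ _ test
    where
    test : ∀ u → not ((toℕ u <ᵇ toℕ v) ∧ Connected F u v) ≡ true
    test u with toℕ u <ᵇ toℕ v in u<v
    ... | false = refl
    ... | true  = cong not (root-minimal v u (subst (λ r → toℕ u < toℕ r) (sym root≡v) (<ᵇ⇒< _ _ (≡true⇒T u<v))))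

  private
    distanceΣ : ∀ v → Σ ℕ λ d → d ≤ n × reach d (root v) v ≡ true × (∀ t → t < d → reach t (root v) v ≡ false)
    distanceΣ v = leastℕ (λ t → reach t (root v) v) (root-connected v)

  distance : Fin n → ℕ
  distance v = proj₁ (distanceΣ v)

  distance-≤ : ∀ v → distance v ≤ n
  distance-≤ v = proj₁ (proj₂ (distanceΣ v))

  distance-reach : ∀ v → reach (distance v) (root v) v ≡ true
  distance-reach v = proj₁ (proj₂ (proj₂ (distanceΣ v)))

  distance-minimal : ∀ v t → t < distance v → reach t (root v) v ≡ false
  distance-minimal v = proj₂ (proj₂ (proj₂ (distanceΣ v)))

  distance≡0⇒root : ∀ v → distance v ≡ 0 → root v ≡ v
  distance≡0⇒root v d≡0 = ==⇒≡ _ _ (subst (λ t → reach t (root v) v ≡ true) d≡0 (distance-reach v))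

  root⇒distance≡0 : ∀ v → root v ≡ v → distance v ≡ 0
  root⇒distance≡0 v root≡v = n≤0⇒n≡0 (≮⇒≥ λ 0<d →
    not-¬ (subst (λ r → reach 0 r v ≡ true) (sym root≡v) (==-refl v)) (distance-minimal v 0 0<d))

  parent : ∀ v {d} → distance v ≡ suc d → ∃[ w ] F w v ≡ true × distance w ≤ d
  parent v {d} d≡ with reach-suc⁻ d (subst (λ t → reach t (root v) v ≡ true) d≡ (distance-reach v))
  ... | inj₁ r = ⊥-elim (not-¬ r (distance-minimal v d (subst (d <_) (sym d≡) ≤-refl)))
  ... | inj₂ (w , r , Fwv) = w , Fwv , ≮⇒≥ λ d<dw → not-¬ r′ (distance-minimal w d d<dw)
    where
    r′ : reach d (root w) w ≡ true
    r′ = subst (λ x → reach d x w ≡ true) (trans (sym (root-cong (root-connected v))) (root-cong (reach⇒connected (root v) d r))) r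

  isolated : Fin n → Bool
  isolated v = allV (λ u → not (F v u))

  nontrivial : Fin n → Bool
  nontrivial v = not (isolated v)

  isolated⁻ : ∀ {v} → isolated v ≡ true → ∀ u → F v u ≡ false
  isolated⁻ e u = not-injective (allV⁻ _ e u)

  nontrivial⁻ : ∀ v → nontrivial v ≡ true → ∃[ u ] F v u ≡ true
  nontrivial⁻ v e with Finₚ.any? (λ u → F v u Bool.≟ true)
  ... | yes edge = edge
  ... | no  none = ⊥-elim (not-¬ (allV⁺ _ (λ u → cong not (¬-not (none ∘ (u ,_))))) (not-injective e))

  nontrivial⁺ : ∀ {v u} → F v u ≡ true → nontrivial v ≡ true
  nontrivial⁺ {v} {u} Fvu = cong not (¬-not λ iso → not-¬ Fvu (isolated⁻ iso u))

  reach-isolated : ∀ t {u v} → isolated v ≡ true → reach t u v ≡ true → u ≡ v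
  reach-isolated zero    _   r = ==⇒≡ _ _ r
  reach-isolated (suc t) iso r with reach-suc⁻ t r
  ... | inj₁ r′              = reach-isolated t iso r′
  ... | inj₂ (w , _ , Fwv) = ⊥-elim (not-¬ (trans (F-sym _ w) Fwv) (isolated⁻ iso w))

  connected-nontrivial : ∀ {w v} → nontrivial w ≡ true → Connected F w v ≡ true → nontrivial v ≡ true
  connected-nontrivial {w} nt c = cong not (¬-not λ iso →
    not-¬ nt (cong not (subst (λ x → isolated x ≡ true) (sym (reach-isolated n iso c)) iso)))

  #isolated #nontrivialVertices #nontrivialComponents : ℕ
  #isolated             = count isolated (allFin n)
  #nontrivialVertices   = count nontrivial (allFin n)
  #nontrivialComponents = count (λ v → nontrivial v ∧ isRoot v) (allFin n)

  numComponents≡ : numComponents F ≡ #isolated + #nontrivialComponents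
  numComponents≡ = begin
    numComponents F                                                         ≡⟨ length-filterᵇ isRoot (allFin n) ⟩
    count isRoot (allFin n)                                                 ≡⟨ count-split isRoot isolated (allFin n) ⟩
    count (λ v → isRoot v ∧ isolated v) (allFin n) + count (λ v → isRoot v ∧ nontrivial v) (allFin n)
      ≡⟨ cong₂ _+_ (count-cong _ _ (allFin n) (λ v _ → isolated⇒isRoot v)) (count-cong _ _ (allFin n) (λ v _ → ∧-comm (isRoot v) _)) ⟩
    #isolated + #nontrivialComponents                                       ∎
    where
    open ≡-Reasoning
    isolated⇒isRoot : ∀ v → isRoot v ∧ isolated v ≡ isolated v
    isolated⇒isRoot v with isolated v in iso
    ... | false = ∧-zeroʳ (isRoot v)
    ... | true  = trans (∧-identityʳ (isRoot v)) (isRoot⁺ v (reach-isolated n iso (root-connected v)))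

  #nontrivialVertices+#isolated : #nontrivialVertices + #isolated ≡ n
  #nontrivialVertices+#isolated = trans (count-not isolated (allFin n)) length-allFin

  good⇒3*#nontrivialComponents≤ : Good F → 3 * #nontrivialComponents ≤ #nontrivialVertices
  good⇒3*#nontrivialComponents≤ good = begin
    3 * #nontrivialComponents                                                ≡⟨ *-comm 3 #nontrivialComponents ⟩
    #nontrivialComponents * 3                                                ≡⟨ sumBy-*ʳ _ 3 (allFin n) ⟨
    sumBy (λ w → indicator (nontrivial w ∧ isRoot w) * 3) (allFin n)         ≤⟨ sumBy-mono _ _ (allFin n) (λ w _ → component-≥3 w) ⟩
    sumBy (λ w → count (λ v → nontrivial v ∧ (root v == w)) (allFin n)) (allFin n) ≡⟨ count-partition nontrivial root ⟨
    #nontrivialVertices                                                      ∎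
    where
    open ≤-Reasoning
    component-≥3 : ∀ w → indicator (nontrivial w ∧ isRoot w) * 3 ≤ count (λ v → nontrivial v ∧ (root v == w)) (allFin n)
    component-≥3 w with nontrivial w in nt | isRoot w in is-root
    ... | false | _     = z≤n
    ... | true  | false = z≤n
    ... | true  | true  = ≤-trans three (count-mono _ _ (allFin n) in-component)
      where
      u : Fin n
      u = proj₁ (nontrivial⁻ w nt)
      Fwu : F w u ≡ true
      Fwu = proj₂ (nontrivial⁻ w nt)
      two : 2 ≤ compSize F w
      two = subst (2 ≤_) (sym (length-filterᵇ _ (allFin n)))
        (count-≥2 (Connected F w) (λ w≡u → not-¬ (subst (λ x → F w x ≡ true) (sym w≡u) Fwu) (F-loopless w))
                  (connected-refl w) (edge⇒connected Fwu))
      three : 3 ≤ count (Connected F w) (allFin n)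
      three with m≤n⇒m<n∨m≡n two
      ... | inj₁ 2<size = subst (3 ≤_) (length-filterᵇ _ (allFin n)) 2<size
      ... | inj₂ 2≡size = ⊥-elim (good w (sym 2≡size))
      in-component : ∀ v → v ∈ allFin n → Connected F w v ≡ true → nontrivial v ∧ (root v == w) ≡ true
      in-component v _ c = ∧-true⁺ (connected-nontrivial nt c) (≡⇒== _ _ (trans (sym (root-cong c)) (isRoot⁻ w is-root)))

-- Counting embeddings vertex by vertex

length-concatMap : ∀ (f : A → List B) xs → length (concatMap f xs) ≡ sumBy (length ∘ f) xs
length-concatMap f []       = refl
length-concatMap f (x ∷ xs) = trans (Listₚ.length-++ (f x)) (cong (length (f x) +_) (length-concatMap f xs))

module SequentialCounting {n : ℕ} (F H : Graph n) (D : ℕ) (H-degree : ∀ a → count (λ y → H y a) (allFin n) ≤ D) where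

  _∈ᵇ_ : Fin n → List (Fin n) → Bool
  y ∈ᵇ ys = any (y ==_) ys

  ∈ᵇ⁻ : ∀ {y} ys → y ∈ᵇ ys ≡ true → y ∈ ys
  ∈ᵇ⁻ {y} ys e with z , z∈ys , y=z ← any-true⁻ (y ==_) ys e = subst (_∈ ys) (sym (==⇒≡ y z y=z)) z∈ys

  ∈ᵇ⁺ : ∀ {y ys} → y ∈ ys → y ∈ᵇ ys ≡ true
  ∈ᵇ⁺ {y} y∈ys = any-true⁺ (y ==_) y∈ys (==-refl y)

  count-∈ᵇ : ∀ ys → Unique ys → count (_∈ᵇ ys) (allFin n) ≡ length ys
  count-∈ᵇ []       _            = sumBy-zero (allFin n)
  count-∈ᵇ (z ∷ ys) (z∉ys ∷ uys) = begin
    count (λ y → (y == z) ∨ (y ∈ᵇ ys)) (allFin n)              ≡⟨ count-∨ (_== z) (_∈ᵇ ys) (allFin n) (λ {y} → disjoint {y}) ⟩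
    count (_== z) (allFin n) + count (_∈ᵇ ys) (allFin n)       ≡⟨ cong₂ _+_ (count-== z) (count-∈ᵇ ys uys) ⟩
    suc (length ys)                                            ∎
    where
    open ≡-Reasoning
    disjoint : ∀ {y} → (y == z) ≡ true → (y ∈ᵇ ys) ≡ false
    disjoint {y} y=z rewrite ==⇒≡ y z y=z = ¬-not λ z∈ys → All.lookup z∉ys (∈ᵇ⁻ ys z∈ys) refl

  Assignment : Set
  Assignment = List (Fin n × Fin n)

  extends : Assignment → Fin n → Fin n → Bool
  extends α x y = not (y ∈ᵇ map proj₂ α) ∧ all (λ (u , v) → not (F x u) ∨ H y v) α

  extensions : Assignment → List (Fin n) → List (List (Fin n))
  extensions α []       = [] ∷ []
  extensions α (x ∷ xs) = concatMap (λ y → map (y ∷_) (extensions ((x , y) ∷ α) xs)) (filterᵇ (extends α x) (allFin n))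

  -- Once the vertices in done are placed, an x with an earlier neighbour u must go to an H-neighbour of
  -- the image of u; any other x has at most n ∸ |done| free images.
  choices : List (Fin n) → Fin n → ℕ
  choices done x = if any (F x) done then D else n ∸ length done

  bound : List (Fin n) → List (Fin n) → ℕ
  bound done []       = 1
  bound done (x ∷ xs) = choices done x * bound (x ∷ done) xs

  extends⇒adjacent : ∀ α x {u v} y → (u , v) ∈ α → F x u ≡ true → extends α x y ≡ true → H y v ≡ true
  extends⇒adjacent α x y uv∈α Fxu ext with ∨-true⁻ (all-true⁻ _ α (∧-conicalʳ (not (y ∈ᵇ map proj₂ α)) _ ext) uv∈α)
  ... | inj₁ ¬Fxu = ⊥-elim (not-¬ Fxu (not-injective ¬Fxu))
  ... | inj₂ Hyv  = Hyv

  count-extends : ∀ α x → Unique (map proj₂ α) → count (extends α x) (allFin n) ≤ choices (map proj₁ α) x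
  count-extends α x uα with any (F x) (map proj₁ α) in adjacent
  ... | true with u , u∈ , Fxu ← any-true⁻ (F x) (map proj₁ α) adjacent
             with (_ , v) , uv∈α , refl ← ∈-map⁻ proj₁ u∈
    = ≤-trans (count-mono _ _ (allFin n) (λ y _ → extends⇒adjacent α x y uv∈α Fxu)) (H-degree v)
  ... | false = begin
    count (extends α x) (allFin n)                  ≤⟨ count-mono _ _ (allFin n) (λ y _ → ∧-conicalˡ _ _) ⟩
    count (not ∘ (_∈ᵇ map proj₂ α)) (allFin n)      ≡⟨ count-complement _ _ (count-∈ᵇ (map proj₂ α) uα) ⟩
    n ∸ length (map proj₂ α)                        ≡⟨ cong (n ∸_) (trans (Listₚ.length-map proj₂ α) (sym (Listₚ.length-map proj₁ α))) ⟩
    n ∸ length (map proj₁ α)                        ∎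
    where open ≤-Reasoning

  length-extensions : ∀ α xs → Unique (map proj₂ α) → length (extensions α xs) ≤ bound (map proj₁ α) xs
  length-extensions α []       _  = ≤-refl
  length-extensions α (x ∷ xs) uα = begin
    length (concatMap (λ y → map (y ∷_) (extensions ((x , y) ∷ α) xs)) Y)   ≡⟨ length-concatMap _ Y ⟩
    sumBy (λ y → length (map (y ∷_) (extensions ((x , y) ∷ α) xs))) Y       ≤⟨ sumBy-mono _ _ Y (λ y y∈Y → step y y∈Y) ⟩
    sumBy (λ _ → bound (x ∷ done) xs) Y                                    ≡⟨ sumBy-const _ Y ⟩
    length Y * bound (x ∷ done) xs                                         ≤⟨ *-monoˡ-≤ _ (≤-trans (≤-reflexive (length-filterᵇ _ (allFin n)))
                                                                                                   (count-extends α x uα)) ⟩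
    choices done x * bound (x ∷ done) xs                                   ∎
    where
    open ≤-Reasoning
    done : List (Fin n)
    done = map proj₁ α
    Y : List (Fin n)
    Y = filterᵇ (extends α x) (allFin n)
    fresh : ∀ {y} → y ∈ Y → Unique (map proj₂ ((x , y) ∷ α))
    fresh {y} y∈Y = All.tabulate (λ z∈ y≡z → not-¬ (∈ᵇ⁺ (subst (_∈ map proj₂ α) (sym y≡z) z∈)) (not-injective y∉)) ∷ uα
      where y∉ = ∧-conicalˡ _ _ (proj₂ (∈-filterᵇ⁻ (extends α x) {allFin n} y∈Y))
    step : ∀ y → y ∈ Y → length (map (y ∷_) (extensions ((x , y) ∷ α) xs)) ≤ bound (x ∷ done) xs
    step y y∈Y = ≤-trans (≤-reflexive (Listₚ.length-map _ (extensions ((x , y) ∷ α) xs))) (length-extensions ((x , y) ∷ α) xs (fresh y∈Y))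

  module _ (σ : Vec (Fin n) n) (σ-inj : IsInjective σ) (σF⊆H : image σ F ⊆ᴳ H) where
    open Embeddings F using (image-pullback)

    assignment : List (Fin n) → Assignment
    assignment = map (λ u → u , lookup σ u)

    images∈extensions : ∀ todo done → Unique todo → (∀ {z} → z ∈ todo → z ∉ done) →
                        map (lookup σ) todo ∈ extensions (assignment done) todo
    images∈extensions []         done _            _        = here refl
    images∈extensions (x ∷ todo) done (x∉todo ∷ u) disjoint =
      ∈-concatMap⁺ _ (Any.map (λ { refl → ∈-map⁺ (lookup σ x ∷_) (images∈extensions todo (x ∷ done) u disjoint′) })
                              (∈-filterᵇ⁺ (extends (assignment done) x) (∈-allFin (lookup σ x)) (∧-true⁺ (cong not fresh) consistent)))
      where
      disjoint′ : ∀ {z} → z ∈ todo → z ∉ x ∷ done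
      disjoint′ z∈todo (here refl)  = All.lookup x∉todo z∈todo refl
      disjoint′ z∈todo (there z∈done) = disjoint (there z∈todo) z∈done
      fresh : lookup σ x ∈ᵇ map proj₂ (assignment done) ≡ false
      fresh = ¬-not (σx∉ ∘ ∈ᵇ⁻ _)
        where
        σx∉ : lookup σ x ∉ map proj₂ (assignment done)
        σx∉ σx∈ with _ , uσu∈ , σx≡σu ← ∈-map⁻ proj₂ σx∈ with u , u∈done , refl ← ∈-map⁻ _ uσu∈ =
          disjoint (here refl) (subst (_∈ done) (sym (σ-inj σx≡σu)) u∈done)
      compatible : Fin n × Fin n → Bool
      compatible (u , v) = not (F x u) ∨ H (lookup σ x) v
      consistent : all compatible (assignment done) ≡ true
      consistent = all-true⁺ compatible (assignment done) λ uv∈ →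
        let u , _ , eq = ∈-map⁻ _ uv∈ in subst (λ uv → compatible uv ≡ true) (sym eq) (edge u)
        where
        edge : ∀ u → not (F x u) ∨ H (lookup σ x) (lookup σ u) ≡ true
        edge u with F x u in Fxu
        ... | false = refl
        ... | true  = σF⊆H _ _ (trans (image-pullback σ σ-inj x u) Fxu)

  embeddings≤bound : ∀ ws → Unique ws → (∀ v → v ∈ ws) → Embeddings.embeddings F H ≤ bound [] ws
  embeddings≤bound ws uws ws-complete = begin
    count (λ σ → subGraphᵇ (image σ F) H) (permutations n)   ≡⟨ length-filterᵇ _ (permutations n) ⟨
    length valid                                            ≤⟨ injection⇒length≤ (λ σ → map (lookup σ) ws) images-injective
                                                                                  (Uniqueₚ.filter⁺ _ permutations-unique) valid∈ ⟩
    length (extensions [] ws)                               ≤⟨ length-extensions [] ws [] ⟩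
    bound [] ws                                             ∎
    where
    open ≤-Reasoning
    valid : List (Vec (Fin n) n)
    valid = filterᵇ (λ σ → subGraphᵇ (image σ F) H) (permutations n)
    images-injective : Injective _≡_ _≡_ (λ (σ : Vec (Fin n) n) → map (lookup σ) ws)
    images-injective {σ} {τ} eq = lookup-extensionality σ τ λ v → agree ws eq (ws-complete v)
      where
      agree : ∀ vs → map (lookup σ) vs ≡ map (lookup τ) vs → ∀ {v} → v ∈ vs → lookup σ v ≡ lookup τ v
      agree (w ∷ vs) eq (here refl) = Listₚ.∷-injectiveˡ eq
      agree (w ∷ vs) eq (there v∈)  = agree vs (Listₚ.∷-injectiveʳ eq) v∈
    valid∈ : ∀ {σ} → σ ∈ valid → map (lookup σ) ws ∈ extensions [] ws
    valid∈ {σ} σ∈ = let σ∈P , σF⊆H = ∈-filterᵇ⁻ _ {permutations n} σ∈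
                    in images∈extensions σ (∈-permutations⁻ σ∈P) (subGraphᵇ⁻ _ H σF⊆H) ws [] uws (λ _ ())

-- Breadth-first order

P′-suc : ∀ m k → m P′ suc k ≡ m * ((m ∸ 1) P′ k)
P′-suc m zero    = refl
P′-suc m (suc k) = begin
  (m ∸ suc k) * (m P′ suc k)              ≡⟨ cong (_* (m P′ suc k)) (∸-+-assoc m 1 k) ⟨
  (m ∸ 1 ∸ k) * (m P′ suc k)              ≡⟨ cong ((m ∸ 1 ∸ k) *_) (P′-suc m k) ⟩
  (m ∸ 1 ∸ k) * (m * ((m ∸ 1) P′ k))      ≡⟨ *-Semigroupₚ.x∙yz≈y∙xz (m ∸ 1 ∸ k) m _ ⟩
  m * ((m ∸ 1) P′ suc k)                  ∎
  where open ≡-Reasoning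

∈-ʳ++⁺ : ∀ {x : A} xs {ys} → x ∈ xs ⊎ x ∈ ys → x ∈ xs ʳ++ ys
∈-ʳ++⁺ xs {ys} x∈ = Anyₚ.reverseAcc⁺ ys xs (Sum.swap x∈)

module BreadthFirstOrder {n : ℕ} (F : Graph n) (F-sym : Symmetric F) (F-loopless : Loopless F)
                         (H : Graph n) (D : ℕ) (H-degree : ∀ a → count (λ y → H y a) (allFin n) ≤ D) where
  open Components F F-sym F-loopless
  open SequentialCounting F H D H-degree

  bound-++ : ∀ xs ys done → bound done (xs ++ ys) ≡ bound done xs * bound (xs ʳ++ done) ys
  bound-++ []       ys done = sym (+-identityʳ _)
  bound-++ (x ∷ xs) ys done = trans (cong (choices done x *_) (bound-++ xs ys (x ∷ done))) (sym (*-assoc (choices done x) _ _))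

  bound-no-edges : ∀ xs done → (∀ {x u} → x ∈ xs → u ∈ done ⊎ u ∈ xs → F x u ≡ false) →
                   bound done xs ≡ (n ∸ length done) P′ length xs
  bound-no-edges []       done _         = refl
  bound-no-edges (x ∷ xs) done no-edges = begin
    choices done x * bound (x ∷ done) xs                  ≡⟨ cong₂ _*_ fresh (bound-no-edges xs (x ∷ done) no-edges′) ⟩
    (n ∸ length done) * ((n ∸ suc (length done)) P′ length xs) ≡⟨ cong (λ m → (n ∸ length done) * (m P′ length xs)) one-fewer ⟨
    (n ∸ length done) * ((n ∸ length done ∸ 1) P′ length xs) ≡⟨ P′-suc (n ∸ length done) (length xs) ⟨
    (n ∸ length done) P′ suc (length xs)                 ∎
    where
    open ≡-Reasoning
    one-fewer : n ∸ length done ∸ 1 ≡ n ∸ suc (length done)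
    one-fewer = trans (∸-+-assoc n (length done) 1) (cong (n ∸_) (+-comm (length done) 1))
    fresh : choices done x ≡ n ∸ length done
    fresh rewrite ¬-not {any (F x) done} (λ e → let u , u∈ , Fxu = any-true⁻ (F x) done e in not-¬ Fxu (no-edges (here refl) (inj₁ u∈))) = refl
    no-edges′ : ∀ {y u} → y ∈ xs → u ∈ x ∷ done ⊎ u ∈ xs → F y u ≡ false
    no-edges′ y∈ (inj₁ (here refl))  = no-edges (there y∈) (inj₂ (here refl))
    no-edges′ y∈ (inj₁ (there u∈))  = no-edges (there y∈) (inj₁ u∈)
    no-edges′ y∈ (inj₂ u∈)          = no-edges (there y∈) (inj₂ (there u∈))

  bound-edges : ∀ xs done → (∀ {x} → x ∈ xs → ∃[ u ] u ∈ done × F x u ≡ true) → bound done xs ≡ D ^ length xs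
  bound-edges []       done _     = refl
  bound-edges (x ∷ xs) done edges = cong₂ _*_ adjacent (bound-edges xs (x ∷ done) λ y∈ → let u , u∈ , Fyu = edges (there y∈) in u , there u∈ , Fyu)
    where
    adjacent : choices done x ≡ D
    adjacent rewrite let u , u∈ , Fxu = edges (here refl) in any-true⁺ (F x) u∈ Fxu = refl

  layer : ℕ → List (Fin n)
  layer d = filterᵇ (λ v → nontrivial v ∧ (distance v ≡ᵇ d)) (allFin n)

  layers : ℕ → ℕ → List (Fin n)
  layers a zero    = []
  layers a (suc m) = layer a ++ layers (suc a) m

  isolatedVertices : List (Fin n)
  isolatedVertices = filterᵇ isolated (allFin n)

  order : List (Fin n)
  order = layer 0 ++ (layers 1 n ++ isolatedVertices)

  ∈-layer⁻ : ∀ d {v} → v ∈ layer d → nontrivial v ≡ true × distance v ≡ d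
  ∈-layer⁻ d {v} v∈ = let nt , dv = ∧-true⁻ (nontrivial v) _ (proj₂ (∈-filterᵇ⁻ _ {allFin n} v∈))
                      in nt , ≡ᵇ⇒≡ _ _ (≡true⇒T dv)

  ∈-layer⁺ : ∀ {v} → nontrivial v ≡ true → v ∈ layer (distance v)
  ∈-layer⁺ {v} nt = ∈-filterᵇ⁺ _ (∈-allFin v) (∧-true⁺ nt (T⇒≡true (≡⇒≡ᵇ (distance v) _ refl)))

  ∈-layers⁻ : ∀ a m {v} → v ∈ layers a m → nontrivial v ≡ true × a ≤ distance v
  ∈-layers⁻ a (suc m) v∈ with ∈-++⁻ (layer a) v∈
  ... | inj₁ v∈layer  = Product.map₂ (≤-reflexive ∘ sym) (∈-layer⁻ a v∈layer)
  ... | inj₂ v∈layers = Product.map₂ (≤-trans (n≤1+n a)) (∈-layers⁻ (suc a) m v∈layers)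

  ∈-layers⁺ : ∀ a m {v} → nontrivial v ≡ true → a ≤ distance v → distance v < a + m → v ∈ layers a m
  ∈-layers⁺ a zero    nt a≤d d<a+0 = ⊥-elim (<-irrefl refl (≤-trans d<a+0 (subst (_≤ _) (sym (+-identityʳ a)) a≤d)))
  ∈-layers⁺ a (suc m) {v} nt a≤d d<a+m with m≤n⇒m<n∨m≡n a≤d
  ... | inj₂ refl = ∈-++⁺ˡ (∈-layer⁺ nt)
  ... | inj₁ a<d  = ∈-++⁺ʳ (layer a) (∈-layers⁺ (suc a) m nt a<d (subst (distance v <_) (+-suc a m) d<a+m))

  layer-unique : ∀ d → Unique (layer d)
  layer-unique d = Uniqueₚ.filter⁺ _ allFin-unique

  layers-unique : ∀ a m → Unique (layers a m)
  layers-unique a zero    = []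
  layers-unique a (suc m) = Uniqueₚ.++⁺ (layer-unique a) (layers-unique (suc a) m)
    λ (v∈layer , v∈layers) → <-irrefl (sym (proj₂ (∈-layer⁻ a v∈layer))) (proj₂ (∈-layers⁻ (suc a) m v∈layers))

  isolated-∉-layers : ∀ a m {v} → v ∈ layers a m → v ∈ isolatedVertices → ⊥
  isolated-∉-layers a m v∈layers v∈iso =
    not-¬ (proj₁ (∈-layers⁻ a m v∈layers)) (cong not (proj₂ (∈-filterᵇ⁻ isolated {allFin n} v∈iso)))

  order-unique : Unique order
  order-unique = Uniqueₚ.++⁺ (layer-unique 0) (Uniqueₚ.++⁺ (layers-unique 1 n) (Uniqueₚ.filter⁺ _ allFin-unique)
                                                           (λ (v∈layers , v∈iso) → isolated-∉-layers 1 n v∈layers v∈iso))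
    λ (v∈layer , v∈rest) → case ∈-++⁻ (layers 1 n) v∈rest of λ where
      (inj₁ v∈layers) → <-irrefl (sym (proj₂ (∈-layer⁻ 0 v∈layer))) (proj₂ (∈-layers⁻ 1 n v∈layers))
      (inj₂ v∈iso)    → isolated-∉-layers 0 1 (∈-++⁺ˡ v∈layer) v∈iso

  order-complete : ∀ v → v ∈ order
  order-complete v with isolated v in iso | distance v in dv
  ... | true  | _     = ∈-++⁺ʳ (layer 0) (∈-++⁺ʳ (layers 1 n) (∈-filterᵇ⁺ isolated (∈-allFin v) iso))
  ... | false | zero  = ∈-++⁺ˡ (subst (λ d → v ∈ layer d) dv (∈-layer⁺ (cong not iso)))
  ... | false | suc d = ∈-++⁺ʳ (layer 0) (∈-++⁺ˡ (∈-layers⁺ 1 n (cong not iso) (subst (1 ≤_) (sym dv) (s≤s z≤n)) (s≤s (distance-≤ v))))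

  length-order : length order ≡ n
  length-order = ≤-antisym
    (subst (length order ≤_) length-allFin (unique⊆⇒length≤ order-unique (λ {v} _ → ∈-allFin v)))
    (subst (_≤ length order) length-allFin (unique⊆⇒length≤ allFin-unique (λ {v} _ → order-complete v)))

  length-layer0 : length (layer 0) ≡ #nontrivialComponents
  length-layer0 = trans (length-filterᵇ _ (allFin n)) (count-cong _ _ (allFin n) λ v _ → cong (nontrivial v ∧_) (distance≡0⇔isRoot v))
    where
    distance≡0⇔isRoot : ∀ v → (distance v ≡ᵇ 0) ≡ isRoot v
    distance≡0⇔isRoot v = ⇔→≡ (mk⇔ (λ e → isRoot⁺ v (distance≡0⇒root v (≡ᵇ⇒≡ _ _ (≡true⇒T e))))
                                  (λ e → T⇒≡true (≡⇒≡ᵇ _ _ (root⇒distance≡0 v (isRoot⁻ v e)))))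

  bound-layers : ∀ a m done → 1 ≤ a → (∀ {v} → nontrivial v ≡ true → distance v < a → v ∈ done) →
                 bound done (layers a m) ≡ D ^ length (layers a m)
  bound-layers a zero    done _   _       = refl
  bound-layers a (suc m) done 1≤a earlier = begin
    bound done (layer a ++ layers (suc a) m)                             ≡⟨ bound-++ (layer a) _ done ⟩
    bound done (layer a) * bound (layer a ʳ++ done) (layers (suc a) m)   ≡⟨ cong₂ _*_ (bound-edges (layer a) done has-parent)
                                                                                       (bound-layers (suc a) m _ (m≤n⇒m≤1+n 1≤a) earlier′) ⟩
    D ^ length (layer a) * D ^ length (layers (suc a) m)                 ≡⟨ ^-distribˡ-+-* D (length (layer a)) _ ⟨
    D ^ (length (layer a) + length (layers (suc a) m))                   ≡⟨ cong (D ^_) (Listₚ.length-++ (layer a)) ⟨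
    D ^ length (layer a ++ layers (suc a) m)                             ∎
    where
    open ≡-Reasoning
    has-parent : ∀ {x} → x ∈ layer a → ∃[ u ] u ∈ done × F x u ≡ true
    has-parent {x} x∈ with ∈-layer⁻ a x∈ | distance x in dx
    ... | _ , refl | zero  = ⊥-elim (<-irrefl (sym dx) 1≤a)
    ... | _ , d≡a  | suc d with w , Fwx , dw≤d ← parent x dx =
      w , earlier (nontrivial⁺ Fwx) (≤-<-trans dw≤d (subst (d <_) (trans (sym dx) d≡a) ≤-refl)) , trans (F-sym x w) Fwx
    earlier′ : ∀ {v} → nontrivial v ≡ true → distance v < suc a → v ∈ layer a ʳ++ done
    earlier′ {v} nt d<1+a with m≤n⇒m<n∨m≡n (s≤s⁻¹ d<1+a)
    ... | inj₁ d<a = ∈-ʳ++⁺ (layer a) (inj₂ (earlier nt d<a))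
    ... | inj₂ d≡a = ∈-ʳ++⁺ (layer a) (inj₁ (subst (λ d → v ∈ layer d) d≡a (∈-layer⁺ nt)))

  bound-order : bound [] order ≡ (n P′ #nontrivialComponents) * D ^ (#nontrivialVertices ∸ #nontrivialComponents) * #isolated !
  bound-order = begin
    bound [] (layer 0 ++ (layers 1 n ++ isolatedVertices))                               ≡⟨ bound-++ (layer 0) _ [] ⟩
    bound [] (layer 0) * bound done₁ (layers 1 n ++ isolatedVertices)                    ≡⟨ cong (bound [] (layer 0) *_) (bound-++ (layers 1 n) isolatedVertices done₁) ⟩
    bound [] (layer 0) * (bound done₁ (layers 1 n) * bound done₂ isolatedVertices)       ≡⟨ *-assoc (bound [] (layer 0)) _ _ ⟨
    bound [] (layer 0) * bound done₁ (layers 1 n) * bound done₂ isolatedVertices         ≡⟨ cong₂ _*_ (cong₂ _*_ roots middle) isolated-last ⟩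
    (n P′ #nontrivialComponents) * D ^ (#nontrivialVertices ∸ #nontrivialComponents) * #isolated ! ∎
    where
    open ≡-Reasoning
    done₁ done₂ : List (Fin n)
    done₁ = layer 0 ʳ++ []
    done₂ = layers 1 n ʳ++ done₁
    L : ℕ
    L = length (layers 1 n)

    adjacent-roots-equal : ∀ {x u} → x ∈ layer 0 → u ∈ layer 0 → F x u ≡ true → x ≡ u
    adjacent-roots-equal {x} {u} x∈ u∈ Fxu =
      trans (sym (distance≡0⇒root x (proj₂ (∈-layer⁻ 0 x∈))))
            (trans (root-cong (edge⇒connected Fxu)) (distance≡0⇒root u (proj₂ (∈-layer⁻ 0 u∈))))
    roots-independent : ∀ {x u} → x ∈ layer 0 → u ∈ [] ⊎ u ∈ layer 0 → F x u ≡ false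
    roots-independent {x} x∈ (inj₂ u∈) = ¬-not λ Fxu →
      not-¬ (subst (λ y → F x y ≡ true) (sym (adjacent-roots-equal x∈ u∈ Fxu)) Fxu) (F-loopless x)
    roots : bound [] (layer 0) ≡ n P′ #nontrivialComponents
    roots = trans (bound-no-edges (layer 0) [] roots-independent) (cong (n P′_) length-layer0)

    s+L+c≡n : #nontrivialComponents + (L + #isolated) ≡ n
    s+L+c≡n = begin
      #nontrivialComponents + (L + #isolated)                       ≡⟨ cong₂ _+_ length-layer0 (cong (L +_) (length-filterᵇ isolated (allFin n))) ⟨
      length (layer 0) + (L + length isolatedVertices)              ≡⟨ cong (length (layer 0) +_) (Listₚ.length-++ (layers 1 n)) ⟨
      length (layer 0) + length (layers 1 n ++ isolatedVertices)    ≡⟨ Listₚ.length-++ (layer 0) ⟨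
      length order                                                  ≡⟨ length-order ⟩
      n                                                             ∎
    s+L≡nn : #nontrivialComponents + L ≡ #nontrivialVertices
    s+L≡nn = +-cancelʳ-≡ #isolated _ _ (trans (+-assoc #nontrivialComponents L #isolated) (trans s+L+c≡n (sym #nontrivialVertices+#isolated)))

    L≡nn∸s : L ≡ #nontrivialVertices ∸ #nontrivialComponents
    L≡nn∸s = trans (sym (m+n∸m≡n #nontrivialComponents L)) (cong (_∸ #nontrivialComponents) s+L≡nn)

    middle : bound done₁ (layers 1 n) ≡ D ^ (#nontrivialVertices ∸ #nontrivialComponents)
    middle = trans (bound-layers 1 n done₁ ≤-refl roots-done) (cong (D ^_) L≡nn∸s)
      where
      roots-done : ∀ {v} → nontrivial v ≡ true → distance v < 1 → v ∈ done₁
      roots-done {v} nt d<1 = ∈-ʳ++⁺ (layer 0) (inj₁ (subst (λ d → v ∈ layer d) (n<1⇒n≡0 d<1) (∈-layer⁺ nt)))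

    isolated-last : bound done₂ isolatedVertices ≡ #isolated !
    isolated-last = begin
      bound done₂ isolatedVertices                          ≡⟨ bound-no-edges isolatedVertices done₂ no-edges ⟩
      (n ∸ length done₂) P′ length isolatedVertices         ≡⟨ cong₂ _P′_ (cong (n ∸_) length-done₂) (length-filterᵇ isolated (allFin n)) ⟩
      (n ∸ #nontrivialVertices) P′ #isolated                 ≡⟨ cong (_P′ #isolated) n∸nn≡c ⟩
      #isolated P′ #isolated                                 ≡⟨ nP′n≡n! #isolated ⟩
      #isolated !                                           ∎
      where
      no-edges : ∀ {x u} → x ∈ isolatedVertices → u ∈ done₂ ⊎ u ∈ isolatedVertices → F x u ≡ false
      no-edges x∈ _ = isolated⁻ (proj₂ (∈-filterᵇ⁻ isolated {allFin n} x∈)) _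
      n∸nn≡c : n ∸ #nontrivialVertices ≡ #isolated
      n∸nn≡c = trans (cong (_∸ #nontrivialVertices) (sym #nontrivialVertices+#isolated)) (m+n∸m≡n #nontrivialVertices #isolated)
      length-done₂ : length done₂ ≡ #nontrivialVertices
      length-done₂ = begin
        length done₂                             ≡⟨ Listₚ.length-ʳ++ (layers 1 n) ⟩
        L + length done₁                         ≡⟨ cong (L +_) (trans (Listₚ.length-ʳ++ (layer 0)) (trans (+-identityʳ _) length-layer0)) ⟩
        L + #nontrivialComponents                ≡⟨ +-comm L _ ⟩
        #nontrivialComponents + L                ≡⟨ s+L≡nn ⟩
        #nontrivialVertices                      ∎

-- Degrees in the power of the Hamilton cycle

-- Adding (1 + i) N ∸ i undoes the shift by i modulo N.
+-%-cancelʳ : ∀ N .{{_ : NonZero N}} {x y} i → x < N → y < N → (x + i) % N ≡ (y + i) % N → x ≡ y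
+-%-cancelʳ N {x} {y} i x<N y<N eq = trans (sym (unshift x<N)) (trans (cong (λ z → (z + back) % N) eq) (unshift y<N))
  where
  back : ℕ
  back = suc i * N ∸ i
  unshift : ∀ {x} → x < N → ((x + i) % N + back) % N ≡ x
  unshift {x} x<N = begin
    ((x + i) % N + back) % N              ≡⟨ %-distribˡ-+ ((x + i) % N) back N ⟩
    ((x + i) % N % N + back % N) % N      ≡⟨ cong (λ z → (z + back % N) % N) (m%n%n≡m%n (x + i) N) ⟩
    ((x + i) % N + back % N) % N          ≡⟨ %-distribˡ-+ (x + i) back N ⟨
    (x + i + back) % N                    ≡⟨ cong (_% N) (trans (+-assoc x i back) (cong (x +_) (m+[n∸m]≡n i≤))) ⟩
    (x + suc i * N) % N                   ≡⟨ [m+kn]%n≡m%n x (suc i) N ⟩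
    x % N                                 ≡⟨ m<n⇒m%n≡m x<N ⟩
    x                                     ∎
    where
    open ≡-Reasoning
    i≤ : i ≤ suc i * N
    i≤ = ≤-trans (n≤1+n i) (m≤m*n (suc i) N)

count-any-≤ : ∀ (q : A → B → Bool) js xs → count (λ x → any (q x) js) xs ≤ sumBy (λ j → count (λ x → q x j) xs) js
count-any-≤ q []       xs = ≤-reflexive (sumBy-zero xs)
count-any-≤ q (j ∷ js) xs = ≤-trans (count-∨-≤ (λ x → q x j) (λ x → any (q x) js) xs) (+-monoʳ-≤ _ (count-any-≤ q js xs))

HamPow-degree : ∀ n k (a : Fin n) → count (λ y → HamPow n k y a) (allFin n) ≤ 2 * k
HamPow-degree (suc m) k a = begin
  count (λ y → HamPow N k y a) (allFin N)                              ≤⟨ count-mono _ _ (allFin N) (λ y _ → ∧-conicalʳ (not (y == a)) _) ⟩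
  count (λ y → any (λ j → forward y j ∨ backward y j) (upTo k)) (allFin N) ≤⟨ count-any-≤ (λ y j → forward y j ∨ backward y j) (upTo k) (allFin N) ⟩
  sumBy (λ j → count (λ y → forward y j ∨ backward y j) (allFin N)) (upTo k) ≤⟨ sumBy-mono _ _ (upTo k) (λ j _ → at-most-two j) ⟩
  sumBy (λ _ → 2) (upTo k)                                             ≡⟨ sumBy-const 2 (upTo k) ⟩
  length (upTo k) * 2                                                  ≡⟨ cong (_* 2) (Listₚ.length-upTo k) ⟩
  k * 2                                                                ≡⟨ *-comm k 2 ⟩
  2 * k                                                                ∎
  where
  open ≤-Reasoning
  N : ℕ
  N = suc m
  forward backward : Fin N → ℕ → Bool
  forward  y j = ((toℕ y + suc j) % N) ≡ᵇ toℕ a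
  backward y j = ((toℕ a + suc j) % N) ≡ᵇ toℕ y
  ≡ᵇ-sound : ∀ x y → (x ≡ᵇ y) ≡ true → x ≡ y
  ≡ᵇ-sound x y e = ≡ᵇ⇒≡ x y (≡true⇒T e)
  forward-unique : ∀ j {x y} → forward x j ≡ true → forward y j ≡ true → x ≡ y
  forward-unique j {x} {y} fx fy = Finₚ.toℕ-injective (+-%-cancelʳ N (suc j) (Finₚ.toℕ<n x) (Finₚ.toℕ<n y)
    (trans (≡ᵇ-sound ((toℕ x + suc j) % N) (toℕ a) fx) (sym (≡ᵇ-sound ((toℕ y + suc j) % N) (toℕ a) fy))))
  backward-unique : ∀ j {x y} → backward x j ≡ true → backward y j ≡ true → x ≡ y
  backward-unique j {x} {y} bx by = Finₚ.toℕ-injective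
    (trans (sym (≡ᵇ-sound ((toℕ a + suc j) % N) (toℕ x) bx)) (≡ᵇ-sound ((toℕ a + suc j) % N) (toℕ y) by))
  at-most-two : ∀ j → count (λ y → forward y j ∨ backward y j) (allFin N) ≤ 2
  at-most-two j = ≤-trans (count-∨-≤ (λ y → forward y j) (λ y → backward y j) (allFin N))
    (+-mono-≤ (count-≤1 _ (allFin N) allFin-unique λ _ _ → forward-unique j)
              (count-≤1 _ (allFin N) allFin-unique λ _ _ → backward-unique j))

P′-*-! : ∀ {m k} → k ≤ m → (m P′ k) * (m ∸ k) ! ≡ m !
P′-*-! {m}     {zero}  _         = +-identityʳ (m !)
P′-*-! {suc m} {suc k} (s≤s k≤m) = begin
  (suc m P′ suc k) * (m ∸ k) !             ≡⟨ cong (_* (m ∸ k) !) (P′-suc (suc m) k) ⟩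
  suc m * (m P′ k) * (m ∸ k) !             ≡⟨ *-assoc (suc m) (m P′ k) _ ⟩
  suc m * ((m P′ k) * (m ∸ k) !)           ≡⟨ cong (suc m *_) (P′-*-! k≤m) ⟩
  suc m !                                  ∎
  where open ≡-Reasoning

^-distribʳ-* : ∀ m a b → (a * b) ^ m ≡ a ^ m * b ^ m
^-distribʳ-* zero    a b = refl
^-distribʳ-* (suc m) a b = trans (cong (a * b *_) (^-distribʳ-* m a b)) (*-Semigroupₚ.interchange a b (a ^ m) (b ^ m))

-- Each factor (c + i) / i of the binomial coefficient (c + m choose m) is at least (c + r) / r.
binomial-≥-power : ∀ c r m → m ≤ r → c ! * m ! * (c + r) ^ m ≤ (c + m) ! * r ^ m
binomial-≥-power c r zero    _     = subst (λ x → c ! * 1 * 1 ≤ x ! * 1) (sym (+-identityʳ c)) (≤-reflexive (*-identityʳ (c ! * 1)))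
binomial-≥-power c r (suc m) 1+m≤r = begin
  c ! * (suc m * m !) * ((c + r) * (c + r) ^ m)      ≡⟨ regroup (c !) (m !) (suc m) (c + r) ((c + r) ^ m) ⟩
  c ! * m ! * (c + r) ^ m * (suc m * (c + r))        ≤⟨ *-mono-≤ (binomial-≥-power c r m (<⇒≤ 1+m≤r)) factor ⟩
  (c + m) ! * r ^ m * (suc (c + m) * r)              ≡⟨ regroup′ ((c + m) !) (r ^ m) (suc (c + m)) r ⟩
  (suc (c + m) * (c + m) !) * (r * r ^ m)            ≡⟨ cong (λ x → x ! * (r * r ^ m)) (+-suc c m) ⟨
  (c + suc m) ! * (r * r ^ m)                        ∎
  where
  open ≤-Reasoning
  regroup : ∀ a b x y z → a * (x * b) * (y * z) ≡ a * b * z * (x * y)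
  regroup = solve-∀
  regroup′ : ∀ a b x y → a * b * (x * y) ≡ x * a * (y * b)
  regroup′ = solve-∀
  factor : suc m * (c + r) ≤ suc (c + m) * r
  factor = begin
    suc m * (c + r)           ≡⟨ *-distribˡ-+ (suc m) c r ⟩
    suc m * c + suc m * r     ≤⟨ +-monoˡ-≤ (suc m * r) (subst (_≤ c * r) (*-comm c (suc m)) (*-monoʳ-≤ c 1+m≤r)) ⟩
    c * r + suc m * r         ≡⟨ *-distribʳ-+ r c (suc m) ⟨
    (c + suc m) * r           ≡⟨ cong (_* r) (+-suc c m) ⟩
    suc (c + m) * r           ∎

-- In paper notation: (n)ₛ (2k)ʳ c! / n! ≤ (3k / n)ʳ rʳ / r!, using n ∸ s = r + c and 2n ≤ 3(r + c).
embedding-bound-≤ : ∀ {n} k r s c → r + s + c ≡ n → 2 * s ≤ r →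
                    (n P′ s) * (2 * k) ^ r * c ! * n ^ r * r ! ≤ n ! * (3 * k) ^ r * r ^ r
embedding-bound-≤ k r s c refl 2s≤r = begin
  (n P′ s) * (2 * k) ^ r * c ! * n ^ r * r !           ≡⟨ regroup (n P′ s) ((2 * k) ^ r) (c !) (n ^ r) (r !) ⟩
  (n P′ s) * (c ! * r ! * ((2 * k) ^ r * n ^ r))       ≡⟨ cong (λ x → (n P′ s) * (c ! * r ! * x)) (^-distribʳ-* r (2 * k) n) ⟨
  (n P′ s) * (c ! * r ! * (2 * k * n) ^ r)             ≤⟨ *-monoʳ-≤ (n P′ s) (*-monoʳ-≤ (c ! * r !) (^-monoˡ-≤ r 2kn≤3k[c+r])) ⟩
  (n P′ s) * (c ! * r ! * (3 * k * (c + r)) ^ r)       ≡⟨ cong (λ x → (n P′ s) * (c ! * r ! * x)) (^-distribʳ-* r (3 * k) (c + r)) ⟩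
  (n P′ s) * (c ! * r ! * ((3 * k) ^ r * (c + r) ^ r)) ≡⟨ regroup′ (n P′ s) (c ! * r !) ((3 * k) ^ r) ((c + r) ^ r) ⟩
  (n P′ s) * (c ! * r ! * (c + r) ^ r) * (3 * k) ^ r   ≤⟨ *-monoˡ-≤ ((3 * k) ^ r) (*-monoʳ-≤ (n P′ s) (binomial-≥-power c r r ≤-refl)) ⟩
  (n P′ s) * ((c + r) ! * r ^ r) * (3 * k) ^ r         ≡⟨ cong (λ x → (n P′ s) * (x ! * r ^ r) * (3 * k) ^ r) c+r≡n∸s ⟩
  (n P′ s) * ((n ∸ s) ! * r ^ r) * (3 * k) ^ r         ≡⟨ regroup″ (n P′ s) ((n ∸ s) !) (r ^ r) ((3 * k) ^ r) ⟩
  (n P′ s) * (n ∸ s) ! * (3 * k) ^ r * r ^ r           ≡⟨ cong (λ x → x * (3 * k) ^ r * r ^ r) (P′-*-! s≤n) ⟩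
  n ! * (3 * k) ^ r * r ^ r                            ∎
  where
  open ≤-Reasoning
  n : ℕ
  n = r + s + c
  regroup : ∀ p a b x y → p * a * b * x * y ≡ p * (b * y * (a * x))
  regroup = solve-∀
  regroup′ : ∀ p a x y → p * (a * (x * y)) ≡ p * (a * y) * x
  regroup′ = solve-∀
  regroup″ : ∀ p f x y → p * (f * x) * y ≡ p * f * y * x
  regroup″ = solve-∀
  reorder : ∀ r s c → r + s + c ≡ s + (c + r)
  reorder = solve-∀
  distribute : ∀ k r s c → 2 * k * (r + s + c) ≡ k * (2 * r + 2 * s + 2 * c)
  distribute = solve-∀
  collect : ∀ k r c → k * (2 * r + r + 3 * c) ≡ 3 * k * (c + r)
  collect = solve-∀
  s≤n : s ≤ n
  s≤n = ≤-trans (m≤n+m s r) (m≤m+n (r + s) c)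
  c+r≡n∸s : c + r ≡ n ∸ s
  c+r≡n∸s = sym (trans (cong (_∸ s) (reorder r s c)) (m+n∸m≡n s (c + r)))
  2kn≤3k[c+r] : 2 * k * n ≤ 3 * k * (c + r)
  2kn≤3k[c+r] = begin
    2 * k * n                     ≡⟨ distribute k r s c ⟩
    k * (2 * r + 2 * s + 2 * c)   ≤⟨ *-monoʳ-≤ k (+-monoˡ-≤ (2 * c) (+-monoʳ-≤ (2 * r) 2s≤r)) ⟩
    k * (2 * r + r + 2 * c)       ≤⟨ *-monoʳ-≤ k (+-monoʳ-≤ (2 * r + r) (*-monoˡ-≤ c (n≤1+n 2))) ⟩
    k * (2 * r + r + 3 * c)       ≡⟨ collect k r c ⟩
    3 * k * (c + r)               ∎

∈⇒≤-sum : ∀ (g : ℕ → ℕ) {xs x} → x ∈ xs → g x ≤ sum (map g xs)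
∈⇒≤-sum g {y ∷ xs} (here refl) = m≤m+n (g y) _
∈⇒≤-sum g {y ∷ xs} (there x∈)  = ≤-trans (∈⇒≤-sum g x∈) (m≤n+m _ (g y))

power≤expScaled : ∀ r → r ^ r ≤ expScaled r r
power≤expScaled r = begin
  r ^ r                                           ≡⟨ *-identityʳ (r ^ r) ⟨
  r ^ r * 1                                       ≡⟨ cong (r ^ r *_) (n/n≡1 (r !) {{r !≢0}}) ⟨
  r ^ r * ((r !) / (r !)) {{r !≢0}}               ≤⟨ ∈⇒≤-sum (λ j → r ^ j * ((r !) / (j !)) {{j !≢0}}) (∈-upTo⁺ (n<1+n r)) ⟩
  expScaled r r                                   ∎
  where open ≤-Reasoning

ratio-bound : ∀ f .{{_ : NonZero f}} X Y E p q a b e → X * f ≤ E * Y → E * p * q ≤ f * a * b → b ≤ e →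
              X * p * q ≤ Y * a * e
ratio-bound f X Y E p q a b e Xf≤EY Epq≤fab b≤e = *-cancelʳ-≤ _ _ f (begin
  X * p * q * f          ≡⟨ regroup X p q f ⟩
  X * f * (p * q)        ≤⟨ *-monoˡ-≤ (p * q) Xf≤EY ⟩
  E * Y * (p * q)        ≡⟨ regroup′ E Y p q ⟩
  Y * (E * p * q)        ≤⟨ *-monoʳ-≤ Y Epq≤fab ⟩
  Y * (f * a * b)        ≤⟨ *-monoʳ-≤ Y (*-monoʳ-≤ (f * a) b≤e) ⟩
  Y * (f * a * e)        ≡⟨ regroup″ Y f a e ⟩
  Y * a * e * f          ∎)
  where
  open ≤-Reasoning
  regroup : ∀ x p q f → x * p * q * f ≡ x * f * (p * q)
  regroup = solve-∀
  regroup′ : ∀ e y p q → e * y * (p * q) ≡ y * (e * p * q)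
  regroup′ = solve-∀
  regroup″ : ∀ y f a e → y * (f * a * e) ≡ y * a * e * f
  regroup″ = solve-∀

module GoodGraph {n : ℕ} (F : Graph n) (F-sym : Symmetric F) (F-loopless : Loopless F) (good : Good F) where
  open Components F F-sym F-loopless

  private
    s : ℕ
    s = #nontrivialComponents

    3s≤nn : 3 * s ≤ #nontrivialVertices
    3s≤nn = good⇒3*#nontrivialComponents≤ good

    s≤nn : s ≤ #nontrivialVertices
    s≤nn = ≤-trans (m≤m+n s (2 * s)) 3s≤nn

  rank≡ : rank F ≡ #nontrivialVertices ∸ s
  rank≡ = begin
    n ∸ numComponents F                               ≡⟨ cong₂ _∸_ (trans (sym #nontrivialVertices+#isolated) (+-comm _ #isolated)) numComponents≡ ⟩
    (#isolated + #nontrivialVertices) ∸ (#isolated + s) ≡⟨ [m+n]∸[m+o]≡n∸o #isolated #nontrivialVertices s ⟩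
    #nontrivialVertices ∸ s                           ∎
    where open ≡-Reasoning

  rank+components+isolated≡n : rank F + s + #isolated ≡ n
  rank+components+isolated≡n = begin
    rank F + s + #isolated                  ≡⟨ cong (λ r → r + s + #isolated) rank≡ ⟩
    #nontrivialVertices ∸ s + s + #isolated ≡⟨ cong (_+ #isolated) (m∸n+n≡m s≤nn) ⟩
    #nontrivialVertices + #isolated         ≡⟨ #nontrivialVertices+#isolated ⟩
    n                                       ∎
    where open ≡-Reasoning

  2*components≤rank : 2 * s ≤ rank F
  2*components≤rank = subst (2 * s ≤_) (sym rank≡) (m+n≤o⇒m≤o∸n (2 * s) (subst (_≤ #nontrivialVertices) (+-comm s (2 * s)) 3s≤nn))

  embeddings≤ : ∀ H D → (∀ a → count (λ y → H y a) (allFin n) ≤ D) →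
                Embeddings.embeddings F H ≤ (n P′ s) * D ^ rank F * #isolated !
  embeddings≤ H D H-degree = begin
    Embeddings.embeddings F H                         ≤⟨ embeddings≤bound order order-unique order-complete ⟩
    bound [] order                                    ≡⟨ bound-order ⟩
    (n P′ s) * D ^ (#nontrivialVertices ∸ s) * #isolated ! ≡⟨ cong (λ r → (n P′ s) * D ^ r * #isolated !) rank≡ ⟨
    (n P′ s) * D ^ rank F * #isolated !               ∎
    where
    open ≤-Reasoning
    open SequentialCounting F H D H-degree
    open BreadthFirstOrder F F-sym F-loopless H D H-degree

  HamPow-estimate : ∀ k → Embeddings.embeddings F (HamPow n k) * n ^ rank F * rank F ! ≤ n ! * (3 * k) ^ rank F * rank F ^ rank F
  HamPow-estimate k =
    ≤-trans (*-monoˡ-≤ (rank F !) (*-monoˡ-≤ (n ^ rank F) (embeddings≤ (HamPow n k) (2 * k) (HamPow-degree n k))))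
            (embedding-bound-≤ k (rank F) s #isolated rank+components+isolated≡n 2*components≤rank)

lemma2p4 : (n k : ℕ) → 4 ≤ k →
    (F : Graph n) → Symmetric F → Loopless F → F ⊆ᴳ HamPow n k → Good F →
    Σ ℕ (λ N → copies F (HamPow n k) * n ^ rank F * N !
                 ≤ copies F (Complete n) * (3 * k) ^ rank F * expScaled (rank F) N)
lemma2p4 n k _ F F-sym F-loopless _ good =
  r , ratio-bound (n !) {{n !≢0}} (copies F H) (copies F (Complete n)) (embeddings H)
                  (n ^ r) (r !) ((3 * k) ^ r) (r ^ r) (expScaled r r)
                  (copies-ratio F-loopless H) (HamPow-estimate k) (power≤expScaled r)
  where
  open Embeddings F
  open GoodGraph F F-sym F-loopless good
  H : Graph n
  H = HamPow n k
  r : ℕ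
  r = rank F
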